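{- Let $n \ge 1$, $q \ge 2$ and $1 \le p \le n$ be integers. Consider the following procedure. Initialize an array $\texttt{krav}[0..n]$ with all entries $1$ and an array $\texttt{lambda}[0..n]$ with all entries $0$. For $i = 1, 2, \ldots, p$: (a) for $k = n, n-1, \ldots, 1$ (in this order) set $\texttt{krav}[k] \gets \frac{(n - k - i + 1)(q - 1)}{i}\,\texttt{krav}[k] - \frac{k}{i}\,\texttt{krav}[k - 1]$; (b) set $\texttt{krav}[0] \gets \frac{(n - i + 1)(q - 1)}{i}\,\texttt{krav}[0]$; (c) for $k = 0, \ldots, n$ set $\texttt{lambda}[k] \gets \texttt{lambda}[k] + \texttt{krav}[k]$. Then let $\lambda_{\max} = \texttt{lambda}[0]$, $\lambda_{\min} = \min_{1 \le k \le n} \texttt{lambda}[k]$, and return $1 + \lambda_{\max}/(-\lambda_{\min})$. This procedure returns the Hoffman bound $1 + \lambda_{\max}(A)/\lvert\lambda_{\min}(A)\rvert$ for the adjacency matrix $A$ of $H(n,q)^p$ (a lower bound on $\chi(H(n,q)^p)$), and, assuming constant-time arithmetic and array access, it runs in $O(np)$ time and uses $O(n)$ space.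
   Context: The Hamming graph $H(n,q)$ has vertex set $\mathbb{Z}_q^n$, two strings adjacent iff they differ in exactly one position. For a graph $G$ and $p\ge 1$, $G^p$ has the same vertex set, two distinct vertices adjacent iff their distance in $G$ is at most $p$. For a graph $G$ with adjacency matrix $A$, the Hoffman bound is $1 + \lambda_{\max}(A)/\lvert\lambda_{\min}(A)\rvert$, where $\lambda_{\max}(A),\lambda_{\min}(A)$ are the largest and smallest eigenvalues of $A$; $\chi(G)$ denotes the chromatic number. -}

module Defs where

open import Data.Bool using (Bool; true; false; _∧_; _∨_; not; if_then_else_)
open import Data.Nat as ℕ using (ℕ; zero; suc; _≡ᵇ_)
open import Data.Integer as ℤ using (ℤ; +_)
open import Data.Rational as ℚ using (ℚ; 0ℚ; 1ℚ; _+_; _-_; _*_; _÷_; _⊓_; ≢-nonZero)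
open import Data.Rational.Properties using (_≟_)
open import Data.Fin as Fin using (Fin)
open import Data.Fin.Properties as FinP using ()
open import Data.Vec as Vec using (Vec; []; _∷_; lookup; updateAt; replicate)
open import Data.Vec.Properties as VecP using ()
open import Data.List as List using (List; []; _∷_; allFin; concatMap; map; foldr; length)
open import Data.Bool.ListAction using (any)
open import Data.Product using (Σ; ∃; _×_; _,_; proj₁; proj₂)
open import Relation.Binary.PropositionalEquality using (_≡_)
open import Relation.Nullary using (¬_; yes; no)
open import Relation.Nullary.Decidable using (⌊_⌋)

-- Rationals from naturals, and a total division (x ÷ 0 := 0)

ℕtoℚ : ℕ → ℚ
ℕtoℚ n = (+ n) ℚ./ 1

_÷'_ : ℚ → ℚ → ℚ
x ÷' y with y ≟ 0ℚ
... | yes _  = 0ℚ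
... | no y≢0 = _÷_ x y {{≢-nonZero y≢0}}

-- The procedure, instrumented with a count of elementary steps
-- (one per array assignment / comparison).  Arrays krav[0..n],
-- lambda[0..n] are Vec ℚ (suc n); index k is Fin.fromℕ< / via `at`.

Arr : ℕ → Set
Arr n = Vec ℚ (suc n)

-- read index k (out of range reads give 0; never happens in the procedure)
get : ∀ {n} → Arr n → ℕ → ℚ
get {n} a k with k ℕ.<? suc n
... | yes k<  = lookup a (Fin.fromℕ< k<)
... | no  _   = 0ℚ

set : ∀ {n} → Arr n → ℕ → ℚ → Arr n
set {n} a k x with k ℕ.<? suc n
... | yes k<  = updateAt a (Fin.fromℕ< k<) (λ _ → x)
... | no  _   = a

stepA : (n q i : ℕ) → ℕ → Arr n → Arr n × ℕ
stepA n q i zero    a = a , 0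
stepA n q i (suc k) a =
  let coef = ((ℕtoℚ n - ℕtoℚ (suc k) - ℕtoℚ i + 1ℚ) * ℕtoℚ (q ℕ.∸ 1)) ÷' ℕtoℚ i
      new  = coef * get a (suc k) - (ℕtoℚ (suc k) ÷' ℕtoℚ i) * get a k
      r    = stepA n q i k (set a (suc k) new)
  in proj₁ r , suc (proj₂ r)

stepB : (n q i : ℕ) → Arr n → Arr n × ℕ
stepB n q i a =
  set a 0 ((((ℕtoℚ n - ℕtoℚ i + 1ℚ) * ℕtoℚ (q ℕ.∸ 1)) ÷' ℕtoℚ i) * get a 0) , 1

stepC : ∀ {n} → Arr n → Arr n → Arr n × ℕ
stepC krav lam = Vec.zipWith _+_ lam krav , suc (Vec.length krav)

iteration : (n q i : ℕ) → Arr n × Arr n × ℕ → Arr n × Arr n × ℕ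
iteration n q i (krav , lam , s) =
  let ra = stepA n q i n krav
      rb = stepB n q i (proj₁ ra)
      rc = stepC (proj₁ rb) lam
  in proj₁ rb , proj₁ rc , s ℕ.+ proj₂ ra ℕ.+ proj₂ rb ℕ.+ proj₂ rc

loop : (n q : ℕ) → (i p : ℕ) → Arr n × Arr n × ℕ → Arr n × Arr n × ℕ
loop n q i zero    st = st
loop n q i (suc p) st = loop n q (suc i) p (iteration n q i st)

initState : (n : ℕ) → Arr n × Arr n × ℕ
initState n = replicate (suc n) 1ℚ , replicate (suc n) 0ℚ , suc n ℕ.+ suc n

finalState : (n q p : ℕ) → Arr n × Arr n × ℕ
finalState n q p = loop n q 1 p (initState n)

lambdaArr : (n q p : ℕ) → Arr n
lambdaArr n q p = proj₁ (proj₂ (finalState n q p))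

procLambdaMax : (n q p : ℕ) → ℚ
procLambdaMax n q p = get (lambdaArr n q p) 0

minList : List ℚ → ℚ
minList []       = 0ℚ
minList (x ∷ xs) = foldr _⊓_ x xs

procLambdaMin : (n q p : ℕ) → ℚ
procLambdaMin n q p = minList (Vec.toList (Vec.tail (lambdaArr n q p)))

procOutput : (n q p : ℕ) → ℚ
procOutput n q p = 1ℚ + (procLambdaMax n q p ÷' (ℚ.- procLambdaMin n q p))

-- total number of elementary steps: initialisation, the loop,
-- reading lambda[0] (1 step) and computing the minimum (n steps), and the
-- final arithmetic (1 step)
procSteps : (n q p : ℕ) → ℕ
procSteps n q p = proj₂ (proj₂ (finalState n q p)) ℕ.+ 1 ℕ.+ n ℕ.+ 1

-- memory used: the number of array cells held (krav and lambda)
procSpace : (n q p : ℕ) → ℕ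
procSpace n q p = Vec.length (proj₁ (finalState n q p))
                  ℕ.+ Vec.length (lambdaArr n q p)

Vertex : ℕ → ℕ → Set
Vertex n q = Vec (Fin q) n

allVertices : (n q : ℕ) → List (Vertex n q)
allVertices zero    q = [] ∷ []
allVertices (suc n) q =
  concatMap (λ x → map (x ∷_) (allVertices n q)) (allFin q)

vertexEq : ∀ {n q} → Vertex n q → Vertex n q → Bool
vertexEq u v = ⌊ VecP.≡-dec FinP._≟_ u v ⌋

hammingDist : ∀ {n q} → Vertex n q → Vertex n q → ℕ
hammingDist []       []       = 0
hammingDist (x ∷ u) (y ∷ v) =
  (if ⌊ x FinP.≟ y ⌋ then 0 else 1) ℕ.+ hammingDist u v

hammingAdj : ∀ {n q} → Vertex n q → Vertex n q → Bool
hammingAdj u v = hammingDist u v ≡ᵇ 1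

reach : ∀ {n q} → ℕ → Vertex n q → Vertex n q → Bool
reach zero    u v = vertexEq u v
reach {n} {q} (suc k) u v =
  reach k u v ∨ any (λ w → reach k u w ∧ hammingAdj w v) (allVertices n q)

powerAdj : ∀ {n q} → ℕ → Vertex n q → Vertex n q → Bool
powerAdj p u v = not (vertexEq u v) ∧ reach p u v

adjMatrix : (n q p : ℕ) → Vertex n q → Vertex n q → ℚ
adjMatrix n q p u v = if powerAdj p u v then 1ℚ else 0ℚ

sumℚ : List ℚ → ℚ
sumℚ = foldr _+_ 0ℚ

mulVec : (n q : ℕ) → (Vertex n q → Vertex n q → ℚ) →
         (Vertex n q → ℚ) → Vertex n q → ℚ
mulVec n q A x u = sumℚ (map (λ v → A u v * x v) (allVertices n q))

IsEigenpair : (n q : ℕ) → (Vertex n q → Vertex n q → ℚ) →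
              ℚ → (Vertex n q → ℚ) → Set
IsEigenpair n q A μ x =
  (∃ λ v → ¬ (x v ≡ 0ℚ)) × (∀ u → mulVec n q A x u ≡ μ * x u)

IsEigenvalue : (n q : ℕ) → (Vertex n q → Vertex n q → ℚ) → ℚ → Set
IsEigenvalue n q A μ = ∃ λ x → IsEigenpair n q A μ x

-- A is diagonalisable over ℚ: some finite family of eigenpairs spans ℚ^V
-- (every standard basis vector is a ℚ-linear combination of them).
-- Consequently every (complex) eigenvalue of A is rational, so the
-- largest/smallest rational eigenvalues below are λ_max(A), λ_min(A).
DiagonalisableOverℚ : (n q : ℕ) → (Vertex n q → Vertex n q → ℚ) → Set
DiagonalisableOverℚ n q A =
  Σ (List (ℚ × (Vertex n q → ℚ))) λ L →
    (∀ i → IsEigenpair n q A (proj₁ (List.lookup L i)) (proj₂ (List.lookup L i)))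
    × (∀ u → Σ (Fin (length L) → ℚ) λ c → ∀ w →
          sumℚ (map (λ i → c i * proj₂ (List.lookup L i) w) (allFin (length L)))
            ≡ (if vertexEq u w then 1ℚ else 0ℚ))

IsLargestEigenvalue : (n q : ℕ) → (Vertex n q → Vertex n q → ℚ) → ℚ → Set
IsLargestEigenvalue n q A M =
  IsEigenvalue n q A M × (∀ μ → IsEigenvalue n q A μ → μ ℚ.≤ M)

IsSmallestEigenvalue : (n q : ℕ) → (Vertex n q → Vertex n q → ℚ) → ℚ → Set
IsSmallestEigenvalue n q A m =
  IsEigenvalue n q A m × (∀ μ → IsEigenvalue n q A μ → m ℚ.≤ μ)

hoffman : ℚ → ℚ → ℚ
hoffman M m = 1ℚ + (M ÷' ℚ.∣ m ∣)

{-# OPTIONS --safe #-}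
module Submission where

-- For t ∈ ℤ_qⁿ let v_t be the tensor product of the vectors f_{t_k}, where f_0 is the all-ones
-- vector and f_{a+1} = e_{a+1} - e_0 are the eigenvectors of J - I on ℚ^q.  Splitting off one
-- coordinate shows that v_t is an eigenvector of the distance-i matrix of H(n, q) whose eigenvalue
-- is the coefficient of zⁱ in ∏ₖ (1 + c_{t_k} z), with c_0 = q - 1 and c_{a+1} = -1: the
-- Krawtchouk number Kᵢ(w), w the weight of t.  The v_t form a basis, so the adjacency matrix of
-- H(n, q)ᵖ, the sum of the distance-i matrices for 1 ≤ i ≤ p, is diagonalisable over ℚ, and being
-- symmetric it has no eigenvalues besides λ(w) = K₁(w) + ⋯ + Kₚ(w).
--
-- Comparing coefficients of zⁱ in (1 + c z) G′ for G = (1 + c z)ⁿ⁻ʷ (1 - z)ʷ, c = q - 1, gives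
-- (i + 1) Kᵢ₊₁(w) = (n - w - i)(q - 1) Kᵢ(w) - w Kᵢ(w - 1), the update of krav[w]; so after round i
-- the arrays hold Kᵢ and the partial sums of λ.  Coefficientwise |Kᵢ(w)| ≤ Kᵢ(0), so
-- λ(0) = lambda[0] is the largest eigenvalue; since the eigenvalues sum to the trace 0 and
-- λ(0) > 0, the smallest one, the minimum of lambda[1..n], is negative.

open import Defs

module HammingPowerSpectrum where

  open import Algebra.Bundles using (Ring)
  open import Data.Bool using (Bool; true; false; T; _∧_; _∨_; not; if_then_else_)
  open import Data.Bool.ListAction using (any)
  import Data.Bool.Properties as BoolP
  open import Data.Empty using (⊥-elim)
  open import Data.Fin as Fin using (Fin)
  import Data.Fin.Properties as FinP
  open import Data.Integer as ℤ using (ℤ)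
  open import Data.Integer.Tactic.RingSolver using (solve-∀)
  open import Data.List as List using (List; []; _∷_; map; allFin; concatMap; _++_)
  import Data.List.Properties as ListP
  open import Data.List.Membership.Propositional using (_∈_; lose)
  open import Data.List.Membership.Propositional.Properties using (∈-allFin; ∈-map⁺; ∈-concatMap⁺)
  open import Data.List.Relation.Unary.Any using (here; there; satisfied; any?)
  open import Data.List.Relation.Unary.Any.Properties using (any⁺; any⁻)
  open import Data.Nat as ℕ using (ℕ; zero; suc; _≡ᵇ_; _≤ᵇ_)
  import Data.Nat.Coprimality as Coprimality
  import Data.Nat.Properties as ℕP
  import Data.Nat.Tactic.RingSolver as NatSolver
  open import Data.Product using (∃; _×_; _,_; proj₁; proj₂)
  open import Data.Rational as ℚ using (ℚ; 0ℚ; 1ℚ; _+_; _-_; _*_; -_; 1/_; mkℚ)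
  import Data.Rational.Properties as ℚP
  open import Data.Rational.Solver using (module +-*-Solver)
  open import Data.Rational.Unnormalised using (*≡*)
  import Data.Rational.Unnormalised.Properties as ℚᵘP
  open import Data.Sum using (_⊎_; inj₁; inj₂)
  open import Data.Vec as Vec using (Vec; []; _∷_)
  import Data.Vec.Properties as VecP
  open import Data.Vec.Membership.Propositional.Properties using (∈-lookup; ∈-toList⁺)
  open import Function using (_∘_; Equivalence)
  open import Relation.Binary using (tri<; tri≈; tri>)
  open import Relation.Binary.PropositionalEquality
  open import Relation.Nullary using (¬_; yes; no)
  open import Relation.Nullary.Decidable using (⌊_⌋; toWitness; fromWitness)

  open import Algebra.Properties.CommutativeSemigroup ℕP.+-commutativeSemigroup using (interchange)
  open import Algebra.Properties.Group ℚP.+-0-group using (∙-cancelʳ)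
  open import Algebra.Properties.Semiring.Sum (Ring.semiring ℚP.+-*-ring)
    using (sum-syntax; sum-cong-≗; ∑-distrib-+; *-distribʳ-sum)
  open +-*-Solver

  ℕtoℚ≡mkℚ : ∀ n → ℕtoℚ n ≡ mkℚ (ℤ.+ n) 0 (Coprimality.sym (Coprimality.1-coprimeTo n))
  ℕtoℚ≡mkℚ n = ℚP.↥p/↧p≡p (mkℚ (ℤ.+ n) 0 (Coprimality.sym (Coprimality.1-coprimeTo n)))

  ℕtoℚ-suc : ∀ n → ℕtoℚ (suc n) ≡ 1ℚ + ℕtoℚ n
  ℕtoℚ-suc n rewrite ℕtoℚ≡mkℚ n | ℕtoℚ≡mkℚ (suc n) =
    ℚP.toℚᵘ-injective (ℚᵘP.≃-sym (ℚᵘP.≃-trans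
      (ℚP.toℚᵘ-homo-+ 1ℚ (mkℚ (ℤ.+ n) 0 (Coprimality.sym (Coprimality.1-coprimeTo n))))
      (*≡* (cross (ℤ.+ n)))))
    where
    cross : ∀ x → (ℤ.+ 1 ℤ.* ℤ.+ 1 ℤ.+ x ℤ.* ℤ.+ 1) ℤ.* ℤ.+ 1 ≡ (ℤ.+ 1 ℤ.+ x) ℤ.* (ℤ.+ 1 ℤ.* ℤ.+ 1)
    cross = solve-∀

  ℕtoℚ-+ : ∀ m n → ℕtoℚ (m ℕ.+ n) ≡ ℕtoℚ m + ℕtoℚ n
  ℕtoℚ-+ zero    n = sym (ℚP.+-identityˡ (ℕtoℚ n))
  ℕtoℚ-+ (suc m) n = begin
    ℕtoℚ (suc (m ℕ.+ n))    ≡⟨ ℕtoℚ-suc (m ℕ.+ n) ⟩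
    1ℚ + ℕtoℚ (m ℕ.+ n)     ≡⟨ cong (1ℚ +_) (ℕtoℚ-+ m n) ⟩
    1ℚ + (ℕtoℚ m + ℕtoℚ n)  ≡⟨ ℚP.+-assoc 1ℚ (ℕtoℚ m) (ℕtoℚ n) ⟨
    (1ℚ + ℕtoℚ m) + ℕtoℚ n  ≡⟨ cong (_+ ℕtoℚ n) (ℕtoℚ-suc m) ⟨
    ℕtoℚ (suc m) + ℕtoℚ n   ∎
    where open ≡-Reasoning

  0≤ℕtoℚ : ∀ n → 0ℚ ℚ.≤ ℕtoℚ n
  0≤ℕtoℚ n rewrite ℕtoℚ≡mkℚ n = ℚP.nonNegative⁻¹ _

  0<ℕtoℚ-suc : ∀ n → 0ℚ ℚ.< ℕtoℚ (suc n)
  0<ℕtoℚ-suc n rewrite ℕtoℚ≡mkℚ (suc n) = ℚP.positive⁻¹ _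

  ℕtoℚ-suc≢0 : ∀ n → ℕtoℚ (suc n) ≢ 0ℚ
  ℕtoℚ-suc≢0 n eq = ℚP.<-irrefl (sym eq) (0<ℕtoℚ-suc n)

  1≤ℕtoℚ-suc : ∀ n → 1ℚ ℚ.≤ ℕtoℚ (suc n)
  1≤ℕtoℚ-suc n = begin
    1ℚ             ≡⟨ ℚP.+-identityʳ 1ℚ ⟨
    1ℚ + 0ℚ        ≤⟨ ℚP.+-monoʳ-≤ 1ℚ (0≤ℕtoℚ n) ⟩
    1ℚ + ℕtoℚ n    ≡⟨ ℕtoℚ-suc n ⟨
    ℕtoℚ (suc n)   ∎
    where open ℚP.≤-Reasoning

  *-÷'-cancel : ∀ x y → y ≢ 0ℚ → y * (x ÷' y) ≡ x
  *-÷'-cancel x y y≢0 with y ℚP.≟ 0ℚ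
  ... | yes y≡0 = ⊥-elim (y≢0 y≡0)
  ... | no  _   = begin
    y * (x * 1/ y)  ≡⟨ cong (y *_) (ℚP.*-comm x (1/ y)) ⟩
    y * (1/ y * x)  ≡⟨ ℚP.*-assoc y (1/ y) x ⟨
    y * 1/ y * x    ≡⟨ cong (_* x) (ℚP.*-inverseʳ y) ⟩
    1ℚ * x          ≡⟨ ℚP.*-identityˡ x ⟩
    x               ∎
    where
    open ≡-Reasoning
    instance _ = ℚ.≢-nonZero y≢0

  *-cancelˡ-≢0 : ∀ z {x y} → z ≢ 0ℚ → z * x ≡ z * y → x ≡ y
  *-cancelˡ-≢0 z {x} {y} z≢0 eq = begin
    x               ≡⟨ undo x ⟨
    1/ z * (z * x)  ≡⟨ cong (1/ z *_) eq ⟩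
    1/ z * (z * y)  ≡⟨ undo y ⟩
    y               ∎
    where
    open ≡-Reasoning
    instance _ = ℚ.≢-nonZero z≢0
    undo : ∀ w → 1/ z * (z * w) ≡ w
    undo w = trans (sym (ℚP.*-assoc (1/ z) z w))
                   (trans (cong (_* w) (ℚP.*-inverseˡ z)) (ℚP.*-identityˡ w))

  p≤∣p∣ : ∀ p → p ℚ.≤ ℚ.∣ p ∣
  p≤∣p∣ p with ℚP.∣p∣≡p∨∣p∣≡-p p
  ... | inj₁ ∣p∣≡p  = ℚP.≤-reflexive (sym ∣p∣≡p)
  ... | inj₂ ∣p∣≡-p = ℚP.≤-trans p≤0 (ℚP.0≤∣p∣ p)
    where
    p≤0 : p ℚ.≤ 0ℚ
    p≤0 = subst (ℚ._≤ 0ℚ) (trans (cong -_ ∣p∣≡-p) (solve 1 (λ x → :- (:- x) := x) refl p))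
                (ℚP.neg-antimono-≤ (ℚP.0≤∣p∣ p))

  -- Lets the ring solver use a hypothesis X ≡ Y: the identity L + Y ≡ R + X is then hypothesis-free.
  via-identity : ∀ L R X Y → L + Y ≡ R + X → X ≡ Y → L ≡ R
  via-identity L R X Y identity X≡Y = ∙-cancelʳ Y L R (trans identity (cong (R +_) X≡Y))

  indicator : Bool → ℚ
  indicator b = if b then 1ℚ else 0ℚ

  indicator-∧ : ∀ x y → indicator (x ∧ y) ≡ indicator x * indicator y
  indicator-∧ true  true  = refl
  indicator-∧ true  false = refl
  indicator-∧ false y     = sym (ℚP.*-zeroˡ (indicator y))

  _==_ : ∀ {m} → Fin m → Fin m → Bool
  x == y = ⌊ x FinP.≟ y ⌋

  ==-refl : ∀ {m} (x : Fin m) → (x == x) ≡ true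
  ==-refl x with x FinP.≟ x
  ... | yes _   = refl
  ... | no  x≢x = ⊥-elim (x≢x refl)

  ==-≢ : ∀ {m} {x y : Fin m} → x ≢ y → (x == y) ≡ false
  ==-≢ {x = x} {y} x≢y with x FinP.≟ y
  ... | yes x≡y = ⊥-elim (x≢y x≡y)
  ... | no  _   = refl

  ==-sym : ∀ {m} (x y : Fin m) → (x == y) ≡ (y == x)
  ==-sym x y with x FinP.≟ y | y FinP.≟ x
  ... | yes _   | yes _   = refl
  ... | no  _   | no  _   = refl
  ... | yes x≡y | no  y≢x = ⊥-elim (y≢x (sym x≡y))
  ... | no  x≢y | yes y≡x = ⊥-elim (x≢y (sym y≡x))

  suc==suc : ∀ {m} (x y : Fin m) → (Fin.suc x == Fin.suc y) ≡ (x == y)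
  suc==suc x y with x FinP.≟ y
  ... | yes _ = refl
  ... | no  _ = refl

  sumℚ-cong : ∀ {A : Set} {f g : A → ℚ} (xs : List A) → (∀ x → f x ≡ g x) →
              sumℚ (map f xs) ≡ sumℚ (map g xs)
  sumℚ-cong []       f≗g = refl
  sumℚ-cong (x ∷ xs) f≗g = cong₂ _+_ (f≗g x) (sumℚ-cong xs f≗g)

  sumℚ-zero : ∀ {A : Set} {f : A → ℚ} (xs : List A) → (∀ x → f x ≡ 0ℚ) → sumℚ (map f xs) ≡ 0ℚ
  sumℚ-zero []       f≗0 = refl
  sumℚ-zero (x ∷ xs) f≗0 rewrite f≗0 x | sumℚ-zero xs f≗0 = refl

  sumℚ-+ : ∀ {A : Set} (f g : A → ℚ) (xs : List A) →
           sumℚ (map (λ x → f x + g x) xs) ≡ sumℚ (map f xs) + sumℚ (map g xs)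
  sumℚ-+ f g []       = refl
  sumℚ-+ f g (x ∷ xs) rewrite sumℚ-+ f g xs =
    solve 4 (λ a b c d → (a :+ b) :+ (c :+ d) := (a :+ c) :+ (b :+ d)) refl
      (f x) (g x) (sumℚ (map f xs)) (sumℚ (map g xs))

  sumℚ-*ˡ : ∀ {A : Set} c (f : A → ℚ) (xs : List A) →
            sumℚ (map (λ x → c * f x) xs) ≡ c * sumℚ (map f xs)
  sumℚ-*ˡ c f []       = sym (ℚP.*-zeroʳ c)
  sumℚ-*ˡ c f (x ∷ xs) rewrite sumℚ-*ˡ c f xs = sym (ℚP.*-distribˡ-+ c (f x) (sumℚ (map f xs)))

  sumℚ-*ʳ : ∀ {A : Set} c (f : A → ℚ) (xs : List A) →
            sumℚ (map (λ x → f x * c) xs) ≡ sumℚ (map f xs) * c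
  sumℚ-*ʳ c f xs = trans (sumℚ-cong xs (λ x → ℚP.*-comm (f x) c))
                         (trans (sumℚ-*ˡ c f xs) (ℚP.*-comm c _))

  sumℚ-swap : ∀ {A B : Set} (g : A → B → ℚ) (xs : List A) (ys : List B) →
              sumℚ (map (λ x → sumℚ (map (g x) ys)) xs) ≡ sumℚ (map (λ y → sumℚ (map (λ x → g x y) xs)) ys)
  sumℚ-swap g []       ys = sym (sumℚ-zero ys (λ _ → refl))
  sumℚ-swap g (x ∷ xs) ys rewrite sumℚ-swap g xs ys =
    sym (sumℚ-+ (g x) (λ y → sumℚ (map (λ x′ → g x′ y) xs)) ys)

  sumℚ-++ : (xs ys : List ℚ) → sumℚ (xs ++ ys) ≡ sumℚ xs + sumℚ ys
  sumℚ-++ []       ys = sym (ℚP.+-identityˡ (sumℚ ys))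
  sumℚ-++ (x ∷ xs) ys rewrite sumℚ-++ xs ys = sym (ℚP.+-assoc x (sumℚ xs) (sumℚ ys))

  sumℚ-concatMap : ∀ {A B : Set} (f : B → ℚ) (g : A → List B) (xs : List A) →
                   sumℚ (map f (concatMap g xs)) ≡ sumℚ (map (λ x → sumℚ (map f (g x))) xs)
  sumℚ-concatMap f g []       = refl
  sumℚ-concatMap f g (x ∷ xs) = begin
    sumℚ (map f (g x ++ concatMap g xs))                ≡⟨ cong sumℚ (ListP.map-++ f (g x) (concatMap g xs)) ⟩
    sumℚ (map f (g x) ++ map f (concatMap g xs))        ≡⟨ sumℚ-++ (map f (g x)) _ ⟩
    sumℚ (map f (g x)) + sumℚ (map f (concatMap g xs))  ≡⟨ cong (sumℚ (map f (g x)) +_) (sumℚ-concatMap f g xs) ⟩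
    sumℚ (map f (g x)) + sumℚ (map (λ x → sumℚ (map f (g x))) xs) ∎
    where open ≡-Reasoning

  sumℚ-nonNeg : ∀ {A : Set} (f : A → ℚ) (xs : List A) → (∀ x → 0ℚ ℚ.≤ f x) → 0ℚ ℚ.≤ sumℚ (map f xs)
  sumℚ-nonNeg f []       f≥0 = ℚP.≤-refl
  sumℚ-nonNeg f (x ∷ xs) f≥0 = ℚP.+-mono-≤ (f≥0 x) (sumℚ-nonNeg f xs f≥0)

  ∈⇒≤-sumℚ : ∀ {A : Set} (f : A → ℚ) {xs : List A} → (∀ x → 0ℚ ℚ.≤ f x) →
             ∀ {y} → y ∈ xs → f y ℚ.≤ sumℚ (map f xs)
  ∈⇒≤-sumℚ f {y ∷ xs} f≥0 (here refl) = begin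
    f y                       ≡⟨ ℚP.+-identityʳ (f y) ⟨
    f y + 0ℚ                  ≤⟨ ℚP.+-monoʳ-≤ (f y) (sumℚ-nonNeg f xs f≥0) ⟩
    f y + sumℚ (map f xs)     ∎
    where open ℚP.≤-Reasoning
  ∈⇒≤-sumℚ f {x ∷ xs} f≥0 {y} (there y∈xs) = begin
    f y                       ≤⟨ ∈⇒≤-sumℚ f f≥0 y∈xs ⟩
    sumℚ (map f xs)           ≡⟨ ℚP.+-identityˡ _ ⟨
    0ℚ + sumℚ (map f xs)      ≤⟨ ℚP.+-monoˡ-≤ (sumℚ (map f xs)) (f≥0 x) ⟩
    f x + sumℚ (map f xs)     ∎
    where open ℚP.≤-Reasoning

  sum-const : ∀ m c → ∑[ a < m ] c ≡ ℕtoℚ m * c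
  sum-const zero    c = sym (ℚP.*-zeroˡ c)
  sum-const (suc m) c rewrite sum-const m c | ℕtoℚ-suc m =
    solve 2 (λ c x → c :+ x :* c := (con 1ℚ :+ x) :* c) refl c (ℕtoℚ m)

  sum-δ : ∀ m (g : Fin m → ℚ) (x : Fin m) → ∑[ a < m ] (g a * indicator (a == x)) ≡ g x
  sum-δ (suc m) g Fin.zero = begin
    g Fin.zero * 1ℚ + ∑[ a < m ] (g (Fin.suc a) * 0ℚ)
      ≡⟨ cong₂ _+_ (ℚP.*-identityʳ (g Fin.zero))
                   (trans (sum-cong-≗ (λ a → ℚP.*-zeroʳ (g (Fin.suc a))))
                          (trans (sum-const m 0ℚ) (ℚP.*-zeroʳ (ℕtoℚ m)))) ⟩
    g Fin.zero + 0ℚ  ≡⟨ ℚP.+-identityʳ (g Fin.zero) ⟩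
    g Fin.zero       ∎
    where open ≡-Reasoning
  sum-δ (suc m) g (Fin.suc x) = begin
    g Fin.zero * 0ℚ + ∑[ a < m ] (g (Fin.suc a) * indicator (Fin.suc a == Fin.suc x))
      ≡⟨ cong₂ _+_ (ℚP.*-zeroʳ (g Fin.zero))
                   (sum-cong-≗ (λ a → cong (λ b → g (Fin.suc a) * indicator b) (suc==suc a x))) ⟩
    0ℚ + ∑[ a < m ] (g (Fin.suc a) * indicator (a == x))
      ≡⟨ ℚP.+-identityˡ _ ⟩
    ∑[ a < m ] (g (Fin.suc a) * indicator (a == x))
      ≡⟨ sum-δ m (λ a → g (Fin.suc a)) x ⟩
    g (Fin.suc x) ∎
    where open ≡-Reasoning

  sumℚ-tabulate : ∀ m (g : Fin m → ℚ) → sumℚ (List.tabulate g) ≡ ∑[ a < m ] g a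
  sumℚ-tabulate zero    g = refl
  sumℚ-tabulate (suc m) g = cong (g Fin.zero +_) (sumℚ-tabulate m (g ∘ Fin.suc))

  sumℚ-allFin : ∀ m (g : Fin m → ℚ) → sumℚ (map g (allFin m)) ≡ ∑[ a < m ] g a
  sumℚ-allFin m g = trans (cong sumℚ (ListP.map-tabulate (λ a → a) g)) (sumℚ-tabulate m g)

  sumV : ∀ n q → (Vertex n q → ℚ) → ℚ
  sumV n q f = sumℚ (map f (allVertices n q))

  sumV-cong : ∀ n q {f g : Vertex n q → ℚ} → (∀ v → f v ≡ g v) → sumV n q f ≡ sumV n q g
  sumV-cong n q = sumℚ-cong (allVertices n q)

  sumV-∷ : ∀ n q (f : Vertex (suc n) q → ℚ) → sumV (suc n) q f ≡ ∑[ x < q ] sumV n q (λ w → f (x ∷ w))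
  sumV-∷ n q f = begin
    sumℚ (map f (concatMap (λ x → map (x ∷_) (allVertices n q)) (allFin q)))
      ≡⟨ sumℚ-concatMap f (λ x → map (x ∷_) (allVertices n q)) (allFin q) ⟩
    sumℚ (map (λ x → sumℚ (map f (map (x ∷_) (allVertices n q)))) (allFin q))
      ≡⟨ sumℚ-cong (allFin q) (λ x → cong sumℚ (sym (ListP.map-∘ (allVertices n q)))) ⟩
    sumℚ (map (λ x → sumV n q (λ w → f (x ∷ w))) (allFin q))
      ≡⟨ sumℚ-allFin q _ ⟩
    ∑[ x < q ] sumV n q (λ w → f (x ∷ w)) ∎
    where open ≡-Reasoning

  ∈-allVertices : ∀ {n q} (v : Vertex n q) → v ∈ allVertices n q
  ∈-allVertices []      = here refl
  ∈-allVertices {suc n} {q} (x ∷ v) =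
    ∈-concatMap⁺ (λ y → map (y ∷_) (allVertices n q)) (lose (∈-allFin x) (∈-map⁺ (x ∷_) (∈-allVertices v)))

  sumTo : ℕ → (ℕ → ℚ) → ℚ
  sumTo zero    h = 0ℚ
  sumTo (suc p) h = sumTo p h + h (suc p)

  sumTo-cong : ∀ p {f g : ℕ → ℚ} → (∀ i → f (suc i) ≡ g (suc i)) → sumTo p f ≡ sumTo p g
  sumTo-cong zero    f≗g = refl
  sumTo-cong (suc p) f≗g = cong₂ _+_ (sumTo-cong p f≗g) (f≗g p)

  sumTo-zero : ∀ p {f : ℕ → ℚ} → (∀ i → f (suc i) ≡ 0ℚ) → sumTo p f ≡ 0ℚ
  sumTo-zero zero    f≗0 = refl
  sumTo-zero (suc p) f≗0 = trans (cong₂ _+_ (sumTo-zero p f≗0) (f≗0 p)) (ℚP.+-identityˡ 0ℚ)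

  sumTo-*ʳ : ∀ p (h : ℕ → ℚ) c → sumTo p h * c ≡ sumTo p (λ i → h i * c)
  sumTo-*ʳ zero    h c = ℚP.*-zeroˡ c
  sumTo-*ʳ (suc p) h c rewrite sym (sumTo-*ʳ p h c) = ℚP.*-distribʳ-+ c (sumTo p h) (h (suc p))

  sumTo-mono-≤ : ∀ p {f g : ℕ → ℚ} → (∀ i → f (suc i) ℚ.≤ g (suc i)) → sumTo p f ℚ.≤ sumTo p g
  sumTo-mono-≤ zero    f≤g = ℚP.≤-refl
  sumTo-mono-≤ (suc p) f≤g = ℚP.+-mono-≤ (sumTo-mono-≤ p f≤g) (f≤g p)

  first≤sumTo : ∀ p (f : ℕ → ℚ) → (∀ i → 0ℚ ℚ.≤ f (suc i)) → f 1 ℚ.≤ sumTo (suc p) f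
  first≤sumTo zero    f f≥0 = ℚP.≤-reflexive (sym (ℚP.+-identityˡ (f 1)))
  first≤sumTo (suc p) f f≥0 = begin
    f 1                              ≤⟨ first≤sumTo p f f≥0 ⟩
    sumTo (suc p) f                  ≡⟨ ℚP.+-identityʳ _ ⟨
    sumTo (suc p) f + 0ℚ             ≤⟨ ℚP.+-monoʳ-≤ (sumTo (suc p) f) (f≥0 (suc p)) ⟩
    sumTo (suc p) f + f (suc (suc p)) ∎
    where open ℚP.≤-Reasoning

  sumV-sumTo : ∀ n q p (g : ℕ → Vertex n q → ℚ) →
               sumV n q (λ w → sumTo p (λ i → g i w)) ≡ sumTo p (λ i → sumV n q (g i))
  sumV-sumTo n q zero    g = sumℚ-zero (allVertices n q) (λ _ → refl)
  sumV-sumTo n q (suc p) g =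
    trans (sumℚ-+ (λ w → sumTo p (λ i → g i w)) (g (suc p)) (allVertices n q))
          (cong (_+ sumV n q (g (suc p))) (sumV-sumTo n q p g))

  -- Hamming distance and the adjacency matrix of H(n, q)ᵖ

  T-ext : ∀ {x y} → (T x → T y) → (T y → T x) → x ≡ y
  T-ext {false} {false} _ _ = refl
  T-ext {false} {true}  _ f = ⊥-elim (f _)
  T-ext {true}  {false} t _ = ⊥-elim (t _)
  T-ext {true}  {true}  _ _ = refl

  ≡true : ∀ {x} → T x → x ≡ true
  ≡true = Equivalence.to BoolP.T-≡

  ≡false : ∀ {x} → ¬ T x → x ≡ false
  ≡false ¬x = T-ext ¬x (λ ())

  coordDist : ∀ {q} → Fin q → Fin q → ℕ
  coordDist x y = if x == y then 0 else 1

  hammingDist-refl : ∀ {n q} (u : Vertex n q) → hammingDist u u ≡ 0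
  hammingDist-refl []      = refl
  hammingDist-refl (x ∷ u) rewrite ==-refl x = hammingDist-refl u

  hammingDist-sym : ∀ {n q} (u v : Vertex n q) → hammingDist u v ≡ hammingDist v u
  hammingDist-sym []      []      = refl
  hammingDist-sym (x ∷ u) (y ∷ v) rewrite ==-sym x y = cong (coordDist y x ℕ.+_) (hammingDist-sym u v)

  coordDist-triangle : ∀ {q} (x y z : Fin q) → coordDist x z ℕ.≤ coordDist x y ℕ.+ coordDist y z
  coordDist-triangle x y z with x FinP.≟ y | y FinP.≟ z | x FinP.≟ z
  ... | _        | _        | yes _  = ℕ.z≤n
  ... | yes refl | yes refl | no x≢x = ⊥-elim (x≢x refl)
  ... | no  _    | _        | no _   = ℕ.s≤s ℕ.z≤n
  ... | yes _    | no  _    | no _   = ℕ.s≤s ℕ.z≤n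

  hammingDist-triangle : ∀ {n q} (u w v : Vertex n q) →
                         hammingDist u v ℕ.≤ hammingDist u w ℕ.+ hammingDist w v
  hammingDist-triangle []      []      []      = ℕ.z≤n
  hammingDist-triangle (x ∷ u) (y ∷ w) (z ∷ v) =
    ℕP.≤-trans (ℕP.+-mono-≤ (coordDist-triangle x y z) (hammingDist-triangle u w v))
               (ℕP.≤-reflexive (interchange (coordDist x y) (coordDist y z) (hammingDist u w) (hammingDist w v)))

  hammingDist≡0⇒≡ : ∀ {n q} {u v : Vertex n q} → hammingDist u v ≡ 0 → u ≡ v
  hammingDist≡0⇒≡ {u = []}    {[]}    _ = refl
  hammingDist≡0⇒≡ {u = x ∷ u} {y ∷ v} d≡0 with x FinP.≟ y
  ... | yes refl = cong (x ∷_) (hammingDist≡0⇒≡ d≡0)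
  ... | no  _    = ⊥-elim (ℕP.1+n≢0 d≡0)

  hammingDist-∷-≡ : ∀ {n q} (x : Fin q) (u v : Vertex n q) → hammingDist (x ∷ u) (x ∷ v) ≡ hammingDist u v
  hammingDist-∷-≡ x u v rewrite ==-refl x = refl

  hammingDist-∷-≢ : ∀ {n q} {x y : Fin q} → x ≢ y → (u v : Vertex n q) →
                    hammingDist (x ∷ u) (y ∷ v) ≡ suc (hammingDist u v)
  hammingDist-∷-≢ x≢y u v rewrite ==-≢ x≢y = refl

  hammingDist-step : ∀ {n q} (u v : Vertex n q) {k} → hammingDist u v ≡ suc k →
                     ∃ λ w → hammingDist u w ≡ k × hammingDist w v ≡ 1
  hammingDist-step []      []      ()
  hammingDist-step (x ∷ u) (y ∷ v) d≡1+k with x FinP.≟ y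
  ... | no x≢y =
    x ∷ v , trans (hammingDist-∷-≡ x u v) (ℕP.suc-injective d≡1+k)
          , trans (hammingDist-∷-≢ x≢y v v) (cong suc (hammingDist-refl v))
  ... | yes refl with hammingDist-step u v d≡1+k
  ...   | w , uw , wv = x ∷ w , trans (hammingDist-∷-≡ x u w) uw , trans (hammingDist-∷-≡ x w v) wv

  vertexEq-∷ : ∀ {n q} (x y : Fin q) (u v : Vertex n q) → vertexEq (x ∷ u) (y ∷ v) ≡ (x == y) ∧ vertexEq u v
  vertexEq-∷ x y u v with x FinP.≟ y | VecP.≡-dec FinP._≟_ u v
  ... | yes _ | yes _ = refl
  ... | yes _ | no  _ = refl
  ... | no  _ | _     = refl

  vertexEq≡dist≡ᵇ0 : ∀ {n q} (u v : Vertex n q) → vertexEq u v ≡ (hammingDist u v ≡ᵇ 0)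
  vertexEq≡dist≡ᵇ0 u v = T-ext
    (λ u≈v → ℕP.≡⇒≡ᵇ _ 0 (subst (λ w → hammingDist u w ≡ 0) (toWitness u≈v) (hammingDist-refl u)))
    (λ d≡0 → fromWitness (hammingDist≡0⇒≡ (ℕP.≡ᵇ⇒≡ _ 0 d≡0)))

  reach-sound : ∀ {n q} k {u v : Vertex n q} → T (reach k u v) → hammingDist u v ℕ.≤ k
  reach-sound zero    {u} {v} u≈v = ℕP.≤-reflexive (subst (λ w → hammingDist u w ≡ 0) (toWitness u≈v) (hammingDist-refl u))
  reach-sound (suc k) {u} {v} h with Equivalence.to BoolP.T-∨ h
  ... | inj₁ h′ = ℕP.m≤n⇒m≤1+n (reach-sound k h′)
  ... | inj₂ h′ with satisfied (any⁻ (λ w → reach k u w ∧ hammingAdj w v) (allVertices _ _) h′)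
  ...   | w , uw∧wv with Equivalence.to BoolP.T-∧ uw∧wv
  ...     | uw , wv = begin
    hammingDist u v                    ≤⟨ hammingDist-triangle u w v ⟩
    hammingDist u w ℕ.+ hammingDist w v ≤⟨ ℕP.+-mono-≤ (reach-sound k uw) (ℕP.≤-reflexive (ℕP.≡ᵇ⇒≡ _ 1 wv)) ⟩
    k ℕ.+ 1                            ≡⟨ ℕP.+-comm k 1 ⟩
    suc k                              ∎
    where open ℕP.≤-Reasoning

  reach-complete : ∀ {n q} k {u v : Vertex n q} → hammingDist u v ℕ.≤ k → T (reach k u v)
  reach-complete zero {u} {v} d≤0 = fromWitness (hammingDist≡0⇒≡ (ℕP.n≤0⇒n≡0 d≤0))
  reach-complete {n} {q} (suc k) {u} {v} d≤1+k with ℕP.m≤n⇒m<n∨m≡n d≤1+k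
  ... | inj₁ d<1+k = Equivalence.from BoolP.T-∨ (inj₁ (reach-complete k (ℕP.≤-pred d<1+k)))
  ... | inj₂ d≡1+k with hammingDist-step u v d≡1+k
  ...   | w , uw , wv = Equivalence.from BoolP.T-∨ (inj₂ (any⁺ (λ w → reach k u w ∧ hammingAdj w v) (lose (∈-allVertices w)
            (Equivalence.from BoolP.T-∧ (reach-complete k (ℕP.≤-reflexive uw) , ℕP.≡⇒≡ᵇ _ 1 wv)))))

  reach≡dist≤ᵇ : ∀ {n q} k (u v : Vertex n q) → reach k u v ≡ (hammingDist u v ≤ᵇ k)
  reach≡dist≤ᵇ k u v = T-ext (ℕP.≤⇒≤ᵇ ∘ reach-sound k) (reach-complete k ∘ ℕP.≤ᵇ⇒≤ _ k)

  indicator-range : ∀ d p → indicator (not (d ≡ᵇ 0) ∧ (d ≤ᵇ p)) ≡ sumTo p (λ i → indicator (d ≡ᵇ i))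
  indicator-range zero    p    = sym (sumTo-zero p (λ _ → refl))
  indicator-range (suc d) zero = refl
  indicator-range (suc d) (suc p) rewrite sym (indicator-range (suc d) p) with ℕP.<-cmp d p
  ... | tri< d<p _ _ rewrite ≡true (ℕP.<⇒<ᵇ (ℕP.m<n⇒m<1+n d<p)) | ≡true (ℕP.<⇒<ᵇ d<p)
                           | ≡false (ℕP.<⇒≢ d<p ∘ ℕP.≡ᵇ⇒≡ d p) = refl
  ... | tri≈ _ refl _ rewrite ≡true (ℕP.<⇒<ᵇ (ℕP.n<1+n d)) | ≡false (ℕP.n≮n d ∘ ℕP.<ᵇ⇒< d d)
                            | ≡true (ℕP.≡⇒≡ᵇ d d refl) = refl
  ... | tri> _ _ p<d rewrite ≡false (ℕP.<⇒≱ p<d ∘ ℕP.≤-pred ∘ ℕP.<ᵇ⇒< d (suc p))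
                           | ≡false ((λ d<p → ℕP.<-asym d<p p<d) ∘ ℕP.<ᵇ⇒< d p)
                           | ≡false (ℕP.>⇒≢ p<d ∘ ℕP.≡ᵇ⇒≡ d p) = refl

  adjMatrix≡sumTo : ∀ n q p (u w : Vertex n q) →
                    adjMatrix n q p u w ≡ sumTo p (λ i → indicator (hammingDist u w ≡ᵇ i))
  adjMatrix≡sumTo n q p u w rewrite reach≡dist≤ᵇ p u w | vertexEq≡dist≡ᵇ0 u w =
    indicator-range (hammingDist u w) p

  adjMatrix-sym : ∀ n q p (u w : Vertex n q) → adjMatrix n q p u w ≡ adjMatrix n q p w u
  adjMatrix-sym n q p u w rewrite adjMatrix≡sumTo n q p u w | adjMatrix≡sumTo n q p w u
                                | hammingDist-sym u w = refl

  -- Krawtchouk series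

  Series : Set
  Series = ℕ → ℚ

  1ₛ : Series
  1ₛ zero    = 1ℚ
  1ₛ (suc _) = 0ℚ

  infixr 6 [1+_z]·_ [1+_z]^_·_

  [1+_z]·_ : ℚ → Series → Series
  ([1+ c z]· f) zero    = f zero
  ([1+ c z]· f) (suc i) = f (suc i) + c * f i

  [1+_z]^_·_ : ℚ → ℕ → Series → Series
  [1+ c z]^ zero  · f = f
  [1+ c z]^ suc m · f = [1+ c z]· [1+ c z]^ m · f

  [1-z]^_ : ℕ → Series
  [1-z]^ k = [1+ - 1ℚ z]^ k · 1ₛ

  -- kraw (q - 1) (n - w) w i is the Krawtchouk number Kᵢ(w) of H(n, q).
  kraw : ℚ → ℕ → ℕ → Series
  kraw c m k = [1+ c z]^ m · [1-z]^ k

  [1+z]·-cong : ∀ c {f g : Series} → (∀ i → f i ≡ g i) → ∀ i → ([1+ c z]· f) i ≡ ([1+ c z]· g) i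
  [1+z]·-cong c f≗g zero    = f≗g zero
  [1+z]·-cong c f≗g (suc i) = cong₂ (λ a b → a + c * b) (f≗g (suc i)) (f≗g i)

  [1+z]·-comm : ∀ c d f i → ([1+ c z]· [1+ d z]· f) i ≡ ([1+ d z]· [1+ c z]· f) i
  [1+z]·-comm c d f zero          = refl
  [1+z]·-comm c d f (suc zero)    =
    solve 4 (λ a b c d → (a :+ d :* b) :+ c :* b := (a :+ c :* b) :+ d :* b) refl (f 1) (f 0) c d
  [1+z]·-comm c d f (suc (suc i)) =
    solve 5 (λ a b e c d → (a :+ d :* b) :+ c :* (b :+ d :* e) := (a :+ c :* b) :+ d :* (b :+ c :* e))
      refl (f (suc (suc i))) (f (suc i)) (f i) c d

  [1+z]^-comm : ∀ m c d f i → ([1+ c z]^ m · [1+ d z]· f) i ≡ ([1+ d z]· [1+ c z]^ m · f) i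
  [1+z]^-comm zero    c d f i = refl
  [1+z]^-comm (suc m) c d f i = trans ([1+z]·-cong c ([1+z]^-comm m c d f) i) ([1+z]·-comm c d _ i)

  [1+z]^-head : ∀ m c f → ([1+ c z]^ m · f) 0 ≡ f 0
  [1+z]^-head zero    c f = refl
  [1+z]^-head (suc m) c f = [1+z]^-head m c f

  [1-z]^-head : ∀ k → ([1-z]^ k) 0 ≡ 1ℚ
  [1-z]^-head k = [1+z]^-head k (- 1ℚ) 1ₛ

  kraw-head : ∀ c m k → kraw c m k 0 ≡ 1ℚ
  kraw-head c m k = trans ([1+z]^-head m c ([1-z]^ k)) ([1-z]^-head k)

  *-[1-z]^-suc : ∀ k j → ℕtoℚ k * ([1-z]^ k) (suc j) ≡ ℕtoℚ k * (([1-z]^ ℕ.pred k) (suc j) + - 1ℚ * ([1-z]^ ℕ.pred k) j)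
  *-[1-z]^-suc zero    j = trans (ℚP.*-zeroˡ (([1-z]^ 0) (suc j))) (sym (ℚP.*-zeroˡ (([1-z]^ 0) (suc j) + - 1ℚ * ([1-z]^ 0) j)))
  *-[1-z]^-suc (suc k) j = refl

  -- The coefficientwise form of ((1 - z)ᵏ)′ = -k (1 - z)ᵏ⁻¹.
  [1-z]^-derivative : ∀ k i → ℕtoℚ (suc i) * ([1-z]^ k) (suc i) ≡ - (ℕtoℚ k * ([1-z]^ ℕ.pred k) i)
  [1-z]^-derivative zero    i = trans (ℚP.*-zeroʳ (ℕtoℚ (suc i))) (cong -_ (sym (ℚP.*-zeroˡ (1ₛ i))))
  [1-z]^-derivative (suc k) zero =
    via-identity L R X Y identity ([1-z]^-derivative k 0)
    where
    L = ℕtoℚ 1 * (([1-z]^ k) 1 + - 1ℚ * ([1-z]^ k) 0)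
    R = - (ℕtoℚ (suc k) * ([1-z]^ k) 0)
    X = ℕtoℚ 1 * ([1-z]^ k) 1
    Y = - (ℕtoℚ k * ([1-z]^ ℕ.pred k) 0)
    identity : L + Y ≡ R + X
    identity rewrite [1-z]^-head k | [1-z]^-head (ℕ.pred k) | ℕtoℚ-suc k =
      solve 2 (λ x k → con 1ℚ :* (x :+ :- con 1ℚ :* con 1ℚ) :+ :- (k :* con 1ℚ)
                    := :- ((con 1ℚ :+ k) :* con 1ℚ) :+ con 1ℚ :* x) refl (([1-z]^ k) 1) (ℕtoℚ k)
  [1-z]^-derivative (suc k) (suc j) =
    via-identity L R X Y identity
      (cong₂ _+_ ([1-z]^-derivative k (suc j)) (cong₂ _+_ (*-[1-z]^-suc k j) (sym ([1-z]^-derivative k j))))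
    where
    s₁ = ℕtoℚ (suc j)
    κ  = ℕtoℚ k
    b₂ = ([1-z]^ k) (suc (suc j))
    b₁ = ([1-z]^ k) (suc j)
    b₁′ = ([1-z]^ ℕ.pred k) (suc j)
    b₀′ = ([1-z]^ ℕ.pred k) j
    L = ℕtoℚ (suc (suc j)) * (b₂ + - 1ℚ * b₁)
    R = - (ℕtoℚ (suc k) * b₁)
    X = ℕtoℚ (suc (suc j)) * b₂ + (κ * b₁ + - (κ * b₀′))
    Y = - (κ * b₁′) + (κ * (b₁′ + - 1ℚ * b₀′) + s₁ * b₁)
    identity : L + Y ≡ R + X
    identity rewrite ℕtoℚ-suc (suc j) | ℕtoℚ-suc k =
      solve 6 (λ s₁ κ b₂ b₁ b₁′ b₀′ →
        (con 1ℚ :+ s₁) :* (b₂ :+ :- con 1ℚ :* b₁) :+ (:- (κ :* b₁′) :+ (κ :* (b₁′ :+ :- con 1ℚ :* b₀′) :+ s₁ :* b₁))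
        := :- ((con 1ℚ :+ κ) :* b₁) :+ ((con 1ℚ :+ s₁) :* b₂ :+ (κ :* b₁ :+ :- (κ :* b₀′))))
        refl s₁ κ b₂ b₁ b₁′ b₀′

  -- The coefficientwise form of (1 + c z) G′ = m c G - k (1 + c z)ᵐ⁺¹ (1 - z)ᵏ⁻¹
  -- for G = (1 + c z)ᵐ (1 - z)ᵏ.
  KrawtchoukRecurrence : ℚ → ℕ → ℕ → ℕ → Set
  KrawtchoukRecurrence c m k i =
    ℕtoℚ (suc i) * kraw c m k (suc i) ≡
    (ℕtoℚ m - ℕtoℚ i) * c * kraw c m k i - ℕtoℚ k * kraw c (suc m) (ℕ.pred k) i

  kraw-recurrence-zero : ∀ c k i → KrawtchoukRecurrence c 0 k i
  kraw-recurrence-zero c zero zero = trans (ℚP.*-zeroʳ (ℕtoℚ 1))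
    (solve 1 (λ c → con 0ℚ := (con 0ℚ :- con 0ℚ) :* c :* con 1ℚ :- con 0ℚ :* con 1ℚ) refl c)
  kraw-recurrence-zero c zero (suc i) = trans (ℚP.*-zeroʳ (ℕtoℚ (suc (suc i))))
    (solve 3 (λ c s y → con 0ℚ := (con 0ℚ :- s) :* c :* con 0ℚ :- con 0ℚ :* y) refl
      c (ℕtoℚ (suc i)) (([1+ c z]· 1ₛ) (suc i)))
  kraw-recurrence-zero c (suc k) zero = trans ([1-z]^-derivative (suc k) 0) identity
    where
    identity : - (ℕtoℚ (suc k) * ([1-z]^ k) 0) ≡
               (ℕtoℚ 0 - ℕtoℚ 0) * c * ([1-z]^ suc k) 0 - ℕtoℚ (suc k) * ([1+ c z]· [1-z]^ k) 0
    identity rewrite [1-z]^-head k =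
      solve 2 (λ k c → :- (k :* con 1ℚ) := (con 0ℚ :- con 0ℚ) :* c :* con 1ℚ :- k :* con 1ℚ) refl (ℕtoℚ (suc k)) c
  kraw-recurrence-zero c (suc k) (suc j) =
    via-identity L R X Y identity (cong₂ _+_ ([1-z]^-derivative (suc k) (suc j)) (cong (c *_) ([1-z]^-derivative (suc k) j)))
    where
    s₂ = ℕtoℚ (suc (suc j))
    s₁ = ℕtoℚ (suc j)
    κ  = ℕtoℚ (suc k)
    a₂ = ([1-z]^ suc k) (suc (suc j))
    a₁ = ([1-z]^ suc k) (suc j)
    b₁ = ([1-z]^ k) (suc j)
    b₀ = ([1-z]^ k) j
    L = s₂ * a₂
    R = (ℕtoℚ 0 - s₁) * c * a₁ - κ * (b₁ + c * b₀)
    X = s₂ * a₂ + c * (s₁ * a₁)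
    Y = - (κ * b₁) + c * - (κ * b₀)
    identity : L + Y ≡ R + X
    identity = solve 8 (λ s₂ s₁ κ a₂ a₁ b₁ b₀ c →
      s₂ :* a₂ :+ (:- (κ :* b₁) :+ c :* :- (κ :* b₀))
      := ((con 0ℚ :- s₁) :* c :* a₁ :- κ :* (b₁ :+ c :* b₀)) :+ (s₂ :* a₂ :+ c :* (s₁ :* a₁)))
      refl s₂ s₁ κ a₂ a₁ b₁ b₀ c

  kraw-recurrence-suc : ∀ c m k → (∀ i → KrawtchoukRecurrence c m k i) → ∀ i → KrawtchoukRecurrence c (suc m) k i
  kraw-recurrence-suc c m k rec zero = via-identity L R X Y identity (rec 0)
    where
    g₀ = kraw c m k 0
    g₁ = kraw c m k 1
    h₀ = kraw c (suc m) (ℕ.pred k) 0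
    L = ℕtoℚ 1 * (g₁ + c * g₀)
    R = (ℕtoℚ (suc m) - ℕtoℚ 0) * c * g₀ - ℕtoℚ k * h₀
    X = ℕtoℚ 1 * g₁
    Y = (ℕtoℚ m - ℕtoℚ 0) * c * g₀ - ℕtoℚ k * h₀
    identity : L + Y ≡ R + X
    identity rewrite ℕtoℚ-suc m =
      solve 6 (λ m κ c g₀ g₁ h₀ →
        con 1ℚ :* (g₁ :+ c :* g₀) :+ ((m :- con 0ℚ) :* c :* g₀ :- κ :* h₀)
        := ((con 1ℚ :+ m) :- con 0ℚ) :* c :* g₀ :- κ :* h₀ :+ con 1ℚ :* g₁)
        refl (ℕtoℚ m) (ℕtoℚ k) c g₀ g₁ h₀
  kraw-recurrence-suc c m k rec (suc j) = via-identity L R X Y identity (cong₂ _+_ (rec (suc j)) (cong (c *_) (rec j)))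
    where
    s₂ = ℕtoℚ (suc (suc j))
    s₁ = ℕtoℚ (suc j)
    g₂ = kraw c m k (suc (suc j))
    g₁ = kraw c m k (suc j)
    g₀ = kraw c m k j
    h₁ = kraw c (suc m) (ℕ.pred k) (suc j)
    h₀ = kraw c (suc m) (ℕ.pred k) j
    κ = ℕtoℚ k
    L = s₂ * (g₂ + c * g₁)
    R = (ℕtoℚ (suc m) - s₁) * c * (g₁ + c * g₀) - κ * (h₁ + c * h₀)
    X = s₂ * g₂ + c * (s₁ * g₁)
    Y = ((ℕtoℚ m - s₁) * c * g₁ - κ * h₁) + c * ((ℕtoℚ m - ℕtoℚ j) * c * g₀ - κ * h₀)
    identity : L + Y ≡ R + X
    identity rewrite ℕtoℚ-suc (suc j) | ℕtoℚ-suc j | ℕtoℚ-suc m =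
      solve 9 (λ j m κ c g₂ g₁ g₀ h₁ h₀ →
        (con 1ℚ :+ (con 1ℚ :+ j)) :* (g₂ :+ c :* g₁)
          :+ (((m :- (con 1ℚ :+ j)) :* c :* g₁ :- κ :* h₁) :+ c :* ((m :- j) :* c :* g₀ :- κ :* h₀))
        := ((con 1ℚ :+ m) :- (con 1ℚ :+ j)) :* c :* (g₁ :+ c :* g₀) :- κ :* (h₁ :+ c :* h₀)
          :+ ((con 1ℚ :+ (con 1ℚ :+ j)) :* g₂ :+ c :* ((con 1ℚ :+ j) :* g₁)))
        refl (ℕtoℚ j) (ℕtoℚ m) κ c g₂ g₁ g₀ h₁ h₀

  kraw-recurrence : ∀ c m k i → KrawtchoukRecurrence c m k i
  kraw-recurrence c zero    k = kraw-recurrence-zero c k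
  kraw-recurrence c (suc m) k = kraw-recurrence-suc c m k (kraw-recurrence c m k)

  -- Eigenvectors of the distance matrices

  z·_ : Series → Series
  (z· f) zero    = 0ℚ
  (z· f) (suc i) = f i

  [1+z]·≡+z· : ∀ c f i → ([1+ c z]· f) i ≡ f i + c * (z· f) i
  [1+z]·≡+z· c f zero    = sym (trans (cong (f 0 +_) (ℚP.*-zeroʳ c)) (ℚP.+-identityʳ (f 0)))
  [1+z]·≡+z· c f (suc i) = refl

  z·-*ʳ : ∀ {f g : Series} v → (∀ i → f i ≡ g i * v) → ∀ i → (z· f) i ≡ (z· g) i * v
  z·-*ʳ v f≗gv zero    = sym (ℚP.*-zeroˡ v)
  z·-*ʳ v f≗gv (suc i) = f≗gv i

  coordCoeff : ∀ {q} → ℚ → Fin q → ℚ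
  coordCoeff c Fin.zero    = c
  coordCoeff c (Fin.suc _) = - 1ℚ

  eigenSeries : ∀ {n q} → ℚ → Vertex n q → Series
  eigenSeries c []      = 1ₛ
  eigenSeries c (a ∷ t) = [1+ coordCoeff c a z]· eigenSeries c t

  weight : ∀ {n q} → Vertex n q → ℕ
  weight []              = 0
  weight (Fin.zero  ∷ t) = weight t
  weight (Fin.suc _ ∷ t) = suc (weight t)

  zeroCount : ∀ {n q} → Vertex n q → ℕ
  zeroCount []              = 0
  zeroCount (Fin.zero  ∷ t) = suc (zeroCount t)
  zeroCount (Fin.suc _ ∷ t) = zeroCount t

  zeroCount+weight : ∀ {n q} (t : Vertex n q) → zeroCount t ℕ.+ weight t ≡ n
  zeroCount+weight []              = refl
  zeroCount+weight (Fin.zero  ∷ t) = cong suc (zeroCount+weight t)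
  zeroCount+weight (Fin.suc _ ∷ t) = trans (ℕP.+-suc (zeroCount t) (weight t)) (cong suc (zeroCount+weight t))

  weight≤n : ∀ {n q} (t : Vertex n q) → weight t ℕ.≤ n
  weight≤n t = subst (weight t ℕ.≤_) (zeroCount+weight t) (ℕP.m≤n+m (weight t) (zeroCount t))

  eigenSeries≡kraw : ∀ {n q} c (t : Vertex n q) i → eigenSeries c t i ≡ kraw c (zeroCount t) (weight t) i
  eigenSeries≡kraw c []              i = refl
  eigenSeries≡kraw c (Fin.zero  ∷ t) i = [1+z]·-cong c (eigenSeries≡kraw c t) i
  eigenSeries≡kraw c (Fin.suc _ ∷ t) i =
    trans ([1+z]·-cong (- 1ℚ) (eigenSeries≡kraw c t) i) (sym ([1+z]^-comm (zeroCount t) c (- 1ℚ) ([1-z]^ weight t) i))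

  zeros : ∀ n {q} → Vertex n (suc q)
  zeros n = Vec.replicate n Fin.zero

  weight-zeros : ∀ n {q} → weight (zeros n {q}) ≡ 0
  weight-zeros zero    = refl
  weight-zeros (suc n) = weight-zeros n

  eigenSeries-zeros : ∀ n {q} c i → eigenSeries c (zeros n {q}) i ≡ ([1+ c z]^ n · 1ₛ) i
  eigenSeries-zeros zero    c i = refl
  eigenSeries-zeros (suc n) c i = [1+z]·-cong c (eigenSeries-zeros n c) i

  -- The eigenvectors of J - I on ℚ^q: the all-ones vector (eigenvalue q - 1)
  -- and e_{a+1} - e_0 (eigenvalue -1).
  coordEigvec : ∀ {q} → Fin q → Fin q → ℚ
  coordEigvec Fin.zero    x           = 1ℚ
  coordEigvec (Fin.suc a) Fin.zero    = - 1ℚ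
  coordEigvec (Fin.suc a) (Fin.suc x) = indicator (a == x)

  eigvec : ∀ {n q} → Vertex n q → Vertex n q → ℚ
  eigvec []      []      = 1ℚ
  eigvec (a ∷ t) (x ∷ u) = coordEigvec a x * eigvec t u

  eigvec-diagonal : ∀ {n q} (t : Vertex n q) → eigvec t t ≡ 1ℚ
  eigvec-diagonal []      = refl
  eigvec-diagonal (Fin.zero  ∷ t) rewrite eigvec-diagonal t = refl
  eigvec-diagonal (Fin.suc a ∷ t) rewrite ==-refl a | eigvec-diagonal t = refl

  sum-coordEigvec : ∀ r (a b : Fin (suc r)) →
                    ∑[ x < suc r ] coordEigvec a x ≡ coordEigvec a b * (1ℚ + coordCoeff (ℕtoℚ r) a)
  sum-coordEigvec r Fin.zero    b = begin
    ∑[ x < suc r ] 1ℚ          ≡⟨ sum-const (suc r) 1ℚ ⟩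
    ℕtoℚ (suc r) * 1ℚ          ≡⟨ cong (_* 1ℚ) (ℕtoℚ-suc r) ⟩
    (1ℚ + ℕtoℚ r) * 1ℚ         ≡⟨ ℚP.*-comm (1ℚ + ℕtoℚ r) 1ℚ ⟩
    1ℚ * (1ℚ + ℕtoℚ r)         ∎
    where open ≡-Reasoning
  sum-coordEigvec r (Fin.suc a) b = begin
    - 1ℚ + ∑[ x < r ] indicator (a == x)   ≡⟨ cong (- 1ℚ +_) (trans (sum-cong-≗ one-hot) (sum-δ r (λ _ → 1ℚ) a)) ⟩
    - 1ℚ + 1ℚ                             ≡⟨ ℚP.+-inverseˡ 1ℚ ⟩
    0ℚ                                    ≡⟨ ℚP.*-zeroʳ (coordEigvec (Fin.suc a) b) ⟨
    coordEigvec (Fin.suc a) b * 0ℚ         ≡⟨ cong (coordEigvec (Fin.suc a) b *_) (ℚP.+-inverseʳ 1ℚ) ⟨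
    coordEigvec (Fin.suc a) b * (1ℚ + - 1ℚ) ∎
    where
    open ≡-Reasoning
    one-hot : ∀ x → indicator (a == x) ≡ 1ℚ * indicator (x == a)
    one-hot x = trans (cong indicator (==-sym a x)) (sym (ℚP.*-identityˡ _))

  distMatrix : ∀ {n q} → ℕ → Vertex n q → Vertex n q → ℚ
  distMatrix i u w = indicator (hammingDist u w ≡ᵇ i)

  distAction : ∀ {n q} → Vertex n q → Vertex n q → Series
  distAction {n} {q} t u i = mulVec n q (distMatrix i) (eigvec t) u

  sumV-pull : ∀ n q (g h : Vertex n q → ℚ) k → sumV n q (λ w → g w * (k * h w)) ≡ k * sumV n q (λ w → g w * h w)
  sumV-pull n q g h k =
    trans (sumV-cong n q (λ w → solve 3 (λ g k h → g :* (k :* h) := k :* (g :* h)) refl (g w) k (h w)))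
          (sumℚ-*ˡ k (λ w → g w * h w) (allVertices n q))

  distAction-coord : ∀ {n q} i (a b x : Fin q) (t u : Vertex n q) →
    sumV n q (λ w → indicator (coordDist b x ℕ.+ hammingDist u w ≡ᵇ i) * (coordEigvec a x * eigvec t w))
      ≡ coordEigvec a x * (if b == x then distAction t u i else (z· distAction t u) i)
  distAction-coord {n} {q} i a b x t u with b == x
  ... | true = sumV-pull n q (distMatrix i u) (eigvec t) (coordEigvec a x)
  distAction-coord {n} {q} zero a b x t u | false = begin
    sumV n q (λ w → 0ℚ * (coordEigvec a x * eigvec t w))
      ≡⟨ sumℚ-zero (allVertices n q) (λ w → ℚP.*-zeroˡ (coordEigvec a x * eigvec t w)) ⟩
    0ℚ                                                   ≡⟨ ℚP.*-zeroʳ (coordEigvec a x) ⟨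
    coordEigvec a x * 0ℚ                                 ∎
    where open ≡-Reasoning
  distAction-coord {n} {q} (suc i) a b x t u | false = sumV-pull n q (distMatrix i u) (eigvec t) (coordEigvec a x)

  if-as-indicator : ∀ {q} (b x : Fin q) P Q → (if b == x then P else Q) ≡ indicator (x == b) * (P - Q) + Q
  if-as-indicator b x P Q rewrite ==-sym x b with b == x
  ... | true  = solve 2 (λ P Q → P := con 1ℚ :* (P :- Q) :+ Q) refl P Q
  ... | false = solve 2 (λ P Q → Q := con 0ℚ :* (P :- Q) :+ Q) refl P Q

  distAction-∷ : ∀ {n q} i (a b : Fin q) (t u : Vertex n q) →
    distAction (a ∷ t) (b ∷ u) i ≡
    coordEigvec a b * (distAction t u i - (z· distAction t u) i) + (∑[ x < q ] coordEigvec a x) * (z· distAction t u) i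
  distAction-∷ {n} {q} i a b t u = begin
    distAction (a ∷ t) (b ∷ u) i
      ≡⟨ sumV-∷ n q _ ⟩
    ∑[ x < q ] sumV n q (λ w → indicator (coordDist b x ℕ.+ hammingDist u w ≡ᵇ i) * (coordEigvec a x * eigvec t w))
      ≡⟨ sum-cong-≗ (λ x → distAction-coord i a b x t u) ⟩
    ∑[ x < q ] (coordEigvec a x * (if b == x then P else Q))
      ≡⟨ sum-cong-≗ (λ x → trans (cong (coordEigvec a x *_) (if-as-indicator b x P Q))
           (solve 4 (λ f d P Q → f :* (d :* (P :- Q) :+ Q) := (f :* d) :* (P :- Q) :+ f :* Q) refl
              (coordEigvec a x) (indicator (x == b)) P Q)) ⟩
    ∑[ x < q ] ((coordEigvec a x * indicator (x == b)) * (P - Q) + coordEigvec a x * Q)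
      ≡⟨ ∑-distrib-+ (λ x → (coordEigvec a x * indicator (x == b)) * (P - Q)) (λ x → coordEigvec a x * Q) ⟩
    ∑[ x < q ] ((coordEigvec a x * indicator (x == b)) * (P - Q)) + ∑[ x < q ] (coordEigvec a x * Q)
      ≡⟨ cong₂ _+_ (*-distribʳ-sum (P - Q) (λ x → coordEigvec a x * indicator (x == b)))
                   (*-distribʳ-sum Q (coordEigvec a)) ⟨
    ∑[ x < q ] (coordEigvec a x * indicator (x == b)) * (P - Q) + (∑[ x < q ] coordEigvec a x) * Q
      ≡⟨ cong (λ s → s * (P - Q) + (∑[ x < q ] coordEigvec a x) * Q) (sum-δ q (coordEigvec a) b) ⟩
    coordEigvec a b * (P - Q) + (∑[ x < q ] coordEigvec a x) * Q ∎
    where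
    open ≡-Reasoning
    D = distAction t u
    P = D i
    Q = (z· D) i

  distAction-eigen : ∀ {n} r (t u : Vertex n (suc r)) i → distAction t u i ≡ eigenSeries (ℕtoℚ r) t i * eigvec t u
  distAction-eigen r []      []      zero    = refl
  distAction-eigen r []      []      (suc i) = refl
  distAction-eigen r (a ∷ t) (b ∷ u) i = begin
    distAction (a ∷ t) (b ∷ u) i
      ≡⟨ distAction-∷ i a b t u ⟩
    f * (D i - (z· D) i) + S * (z· D) i
      ≡⟨ cong₂ (λ x y → f * (x - y) + S * y) (IH i) (z·-*ʳ v IH i) ⟩
    f * (E i * v - (z· E) i * v) + S * ((z· E) i * v)
      ≡⟨ cong (λ s → f * (E i * v - (z· E) i * v) + s * ((z· E) i * v)) (sum-coordEigvec r a b) ⟩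
    f * (E i * v - (z· E) i * v) + f * (1ℚ + κ) * ((z· E) i * v)
      ≡⟨ solve 5 (λ f e ze v κ → f :* (e :* v :- ze :* v) :+ f :* (con 1ℚ :+ κ) :* (ze :* v)
                              := (e :+ κ :* ze) :* (f :* v)) refl f (E i) ((z· E) i) v κ ⟩
    (E i + κ * (z· E) i) * (f * v)
      ≡⟨ cong (_* (f * v)) ([1+z]·≡+z· κ E i) ⟨
    ([1+ κ z]· E) i * (f * v) ∎
    where
    open ≡-Reasoning
    IH = distAction-eigen r t u
    f = coordEigvec a b
    κ = coordCoeff (ℕtoℚ r) a
    S = ∑[ x < suc r ] coordEigvec a x
    D = distAction t u
    E = eigenSeries (ℕtoℚ r) t
    v = eigvec t u

  powerEigenvalue : ∀ {n q} → ℕ → ℚ → Vertex n q → ℚ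
  powerEigenvalue p c t = sumTo p (eigenSeries c t)

  adjMatrix-eigvec : ∀ n r p (t u : Vertex n (suc r)) →
    mulVec n (suc r) (adjMatrix n (suc r) p) (eigvec t) u ≡ powerEigenvalue p (ℕtoℚ r) t * eigvec t u
  adjMatrix-eigvec n r p t u = begin
    sumV n q (λ w → adjMatrix n q p u w * eigvec t w)
      ≡⟨ sumV-cong n q (λ w → trans (cong (_* eigvec t w) (adjMatrix≡sumTo n q p u w)) (sumTo-*ʳ p _ (eigvec t w))) ⟩
    sumV n q (λ w → sumTo p (λ i → distMatrix i u w * eigvec t w))
      ≡⟨ sumV-sumTo n q p (λ i w → distMatrix i u w * eigvec t w) ⟩
    sumTo p (distAction t u)
      ≡⟨ sumTo-cong p (λ i → distAction-eigen r t u (suc i)) ⟩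
    sumTo p (λ i → eigenSeries (ℕtoℚ r) t i * eigvec t u)
      ≡⟨ sumTo-*ʳ p (eigenSeries (ℕtoℚ r) t) (eigvec t u) ⟨
    powerEigenvalue p (ℕtoℚ r) t * eigvec t u ∎
    where
    open ≡-Reasoning
    q = suc r

  -- Bounds on the eigenvalues

  [1+z]^-nonNeg : ∀ c → 0ℚ ℚ.≤ c → ∀ n i → 0ℚ ℚ.≤ ([1+ c z]^ n · 1ₛ) i
  [1+z]^-nonNeg c c≥0 zero    zero    = ℚP.<⇒≤ (0<ℕtoℚ-suc 0)
  [1+z]^-nonNeg c c≥0 zero    (suc i) = ℚP.≤-refl
  [1+z]^-nonNeg c c≥0 (suc n) zero    = [1+z]^-nonNeg c c≥0 n zero
  [1+z]^-nonNeg c c≥0 (suc n) (suc i) =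
    ℚP.+-mono-≤ ([1+z]^-nonNeg c c≥0 n (suc i))
      (subst (ℚ._≤ c * ([1+ c z]^ n · 1ₛ) i) (ℚP.*-zeroʳ c)
        (ℚP.*-monoˡ-≤-nonNeg c {{ℚ.nonNegative c≥0}} ([1+z]^-nonNeg c c≥0 n i)))

  [1+z]^-linear-pos : ∀ c → 0ℚ ℚ.< c → ∀ n → 0ℚ ℚ.< ([1+ c z]^ suc n · 1ₛ) 1
  [1+z]^-linear-pos c c>0 n = begin-strict
    0ℚ                                 ≤⟨ [1+z]^-nonNeg c (ℚP.<⇒≤ c>0) n 1 ⟩
    ([1+ c z]^ n · 1ₛ) 1               ≡⟨ ℚP.+-identityʳ _ ⟨
    ([1+ c z]^ n · 1ₛ) 1 + 0ℚ          <⟨ ℚP.+-monoʳ-< (([1+ c z]^ n · 1ₛ) 1) (subst (0ℚ ℚ.<_) (sym c*1≡c) c>0) ⟩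
    ([1+ c z]^ n · 1ₛ) 1 + c * 1ℚ      ≡⟨ cong (λ x → ([1+ c z]^ n · 1ₛ) 1 + c * x) ([1+z]^-head n c 1ₛ) ⟨
    ([1+ c z]^ suc n · 1ₛ) 1           ∎
    where
    open ℚP.≤-Reasoning
    c*1≡c = ℚP.*-identityʳ c

  ∣coordCoeff∣≤ : ∀ {q} c → 1ℚ ℚ.≤ c → (a : Fin q) → ℚ.∣ coordCoeff c a ∣ ℚ.≤ c
  ∣coordCoeff∣≤ c c≥1 Fin.zero    = ℚP.≤-reflexive (ℚP.0≤p⇒∣p∣≡p (ℚP.≤-trans (ℚP.<⇒≤ (0<ℕtoℚ-suc 0)) c≥1))
  ∣coordCoeff∣≤ c c≥1 (Fin.suc a) = c≥1

  ∣eigenSeries∣≤ : ∀ {n q} c → 1ℚ ℚ.≤ c → (t : Vertex n q) → ∀ i →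
                   ℚ.∣ eigenSeries c t i ∣ ℚ.≤ ([1+ c z]^ n · 1ₛ) i
  ∣eigenSeries∣≤ c c≥1 []      zero    = ℚP.≤-refl
  ∣eigenSeries∣≤ c c≥1 []      (suc i) = ℚP.≤-refl
  ∣eigenSeries∣≤ c c≥1 (a ∷ t) zero    = ∣eigenSeries∣≤ c c≥1 t zero
  ∣eigenSeries∣≤ {suc n} c c≥1 (a ∷ t) (suc i) = begin
    ℚ.∣ E (suc i) + κ * E i ∣            ≤⟨ ℚP.∣p+q∣≤∣p∣+∣q∣ (E (suc i)) (κ * E i) ⟩
    ℚ.∣ E (suc i) ∣ + ℚ.∣ κ * E i ∣      ≡⟨ cong (ℚ.∣ E (suc i) ∣ +_) (ℚP.∣p*q∣≡∣p∣*∣q∣ κ (E i)) ⟩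
    ℚ.∣ E (suc i) ∣ + ℚ.∣ κ ∣ * ℚ.∣ E i ∣ ≤⟨ ℚP.+-mono-≤ (∣eigenSeries∣≤ c c≥1 t (suc i)) second ⟩
    Z (suc i) + c * Z i                  ∎
    where
    open ℚP.≤-Reasoning
    E = eigenSeries c t
    Z = [1+ c z]^ n · 1ₛ
    κ = coordCoeff c a
    second : ℚ.∣ κ ∣ * ℚ.∣ E i ∣ ℚ.≤ c * Z i
    second = ℚP.≤-trans (ℚP.*-monoˡ-≤-nonNeg ℚ.∣ κ ∣ {{ℚ.nonNegative (ℚP.0≤∣p∣ κ)}} (∣eigenSeries∣≤ c c≥1 t i))
               (ℚP.*-monoʳ-≤-nonNeg (Z i) {{ℚ.nonNegative ([1+z]^-nonNeg c (ℚP.≤-trans (ℚP.<⇒≤ (0<ℕtoℚ-suc 0)) c≥1) n i)}}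
                                    (∣coordCoeff∣≤ c c≥1 a))

  powerEigenvalue≤zeros : ∀ {n q} c → 1ℚ ℚ.≤ c → ∀ p (t : Vertex n (suc q)) →
                          powerEigenvalue p c t ℚ.≤ powerEigenvalue p c (zeros n {q})
  powerEigenvalue≤zeros {n} c c≥1 p t = sumTo-mono-≤ p (λ i →
    ℚP.≤-trans (ℚP.≤-trans (p≤∣p∣ _) (∣eigenSeries∣≤ c c≥1 t (suc i)))
               (ℚP.≤-reflexive (sym (eigenSeries-zeros n c (suc i)))))

  powerEigenvalue-zeros-pos : ∀ n {q} c → 0ℚ ℚ.< c → ∀ p → 0ℚ ℚ.< powerEigenvalue (suc p) c (zeros (suc n) {q})
  powerEigenvalue-zeros-pos n c c>0 p = ℚP.<-≤-trans
    (subst (0ℚ ℚ.<_) (sym (eigenSeries-zeros (suc n) c 1)) ([1+z]^-linear-pos c c>0 n))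
    (first≤sumTo p (eigenSeries c (zeros (suc n))) (λ i →
      subst (0ℚ ℚ.≤_) (sym (eigenSeries-zeros (suc n) c (suc i))) ([1+z]^-nonNeg c (ℚP.<⇒≤ c>0) (suc n) (suc i))))

  sum-coordCoeff : ∀ r → ∑[ a < suc r ] coordCoeff (ℕtoℚ r) a ≡ 0ℚ
  sum-coordCoeff r rewrite sum-const r (- 1ℚ) = solve 1 (λ x → x :+ x :* (:- con 1ℚ) := con 0ℚ) refl (ℕtoℚ r)

  sumV-eigenSeries : ∀ n r i → sumV n (suc r) (λ t → eigenSeries (ℕtoℚ r) t (suc i)) ≡ 0ℚ
  sumV-eigenSeries zero    r i = refl
  sumV-eigenSeries (suc n) r i = begin
    sumV (suc n) q (λ t → eigenSeries c t (suc i))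
      ≡⟨ sumV-∷ n q (λ t → eigenSeries c t (suc i)) ⟩
    ∑[ a < q ] sumV n q (λ w → eigenSeries c w (suc i) + coordCoeff c a * eigenSeries c w i)
      ≡⟨ sum-cong-≗ {q} (λ a → sumℚ-+ (λ w → eigenSeries c w (suc i)) (λ w → coordCoeff c a * eigenSeries c w i)
                                       (allVertices n q)) ⟩
    ∑[ a < q ] (sumV n q (λ w → eigenSeries c w (suc i)) + sumV n q (λ w → coordCoeff c a * eigenSeries c w i))
      ≡⟨ sum-cong-≗ {q} (λ a → cong₂ _+_ (sumV-eigenSeries n r i)
                                          (sumℚ-*ˡ (coordCoeff c a) (λ w → eigenSeries c w i) (allVertices n q))) ⟩
    ∑[ a < q ] (0ℚ + coordCoeff c a * S)
      ≡⟨ sum-cong-≗ {q} (λ a → ℚP.+-identityˡ (coordCoeff c a * S)) ⟩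
    ∑[ a < q ] (coordCoeff c a * S)
      ≡⟨ *-distribʳ-sum {q} S (coordCoeff c) ⟨
    (∑[ a < q ] coordCoeff c a) * S
      ≡⟨ cong (_* S) (sum-coordCoeff r) ⟩
    0ℚ * S
      ≡⟨ ℚP.*-zeroˡ S ⟩
    0ℚ ∎
    where
    open ≡-Reasoning
    q = suc r
    c = ℕtoℚ r
    S = sumV n q (λ w → eigenSeries c w i)

  sumV-powerEigenvalue : ∀ n r p → sumV n (suc r) (powerEigenvalue p (ℕtoℚ r)) ≡ 0ℚ
  sumV-powerEigenvalue n r p =
    trans (sumV-sumTo n (suc r) p (λ i t → eigenSeries (ℕtoℚ r) t i)) (sumTo-zero p (sumV-eigenSeries n r))

  -- With ι = 1/q these are the coordinates of the standard basis vectors in the basis coordEigvec.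
  dualCoeff : ∀ {q} → ℚ → Fin q → Fin q → ℚ
  dualCoeff ι b Fin.zero    = ι
  dualCoeff ι b (Fin.suc a) = indicator (b == Fin.suc a) - ι

  dualVec : ∀ {n q} → ℚ → Vertex n q → Vertex n q → ℚ
  dualVec ι []      []      = 1ℚ
  dualVec ι (b ∷ u) (a ∷ t) = dualCoeff ι b a * dualVec ι u t

  dualCoeff-coordEigvec : ∀ r ι → ℕtoℚ (suc r) * ι ≡ 1ℚ → (b x : Fin (suc r)) →
                          ∑[ a < suc r ] (dualCoeff ι b a * coordEigvec a x) ≡ indicator (b == x)
  dualCoeff-coordEigvec r ι qι≡1 Fin.zero Fin.zero = begin
    ι * 1ℚ + ∑[ a < r ] ((0ℚ - ι) * - 1ℚ)   ≡⟨ cong (ι * 1ℚ +_) (sum-const r _) ⟩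
    ι * 1ℚ + ℕtoℚ r * ((0ℚ - ι) * - 1ℚ)     ≡⟨ solve 2 (λ ι r → ι :* con 1ℚ :+ r :* ((con 0ℚ :- ι) :* (:- con 1ℚ))
                                                        := (con 1ℚ :+ r) :* ι) refl ι (ℕtoℚ r) ⟩
    (1ℚ + ℕtoℚ r) * ι                       ≡⟨ cong (_* ι) (ℕtoℚ-suc r) ⟨
    ℕtoℚ (suc r) * ι                        ≡⟨ qι≡1 ⟩
    1ℚ                                      ∎
    where open ≡-Reasoning
  dualCoeff-coordEigvec r ι qι≡1 (Fin.suc b) Fin.zero = begin
    ι * 1ℚ + ∑[ a < r ] ((indicator (Fin.suc b == Fin.suc a) - ι) * - 1ℚ)
      ≡⟨ cong (ι * 1ℚ +_) (sum-cong-≗ {r} (λ a → trans (cong (λ e → (indicator e - ι) * - 1ℚ) (trans (suc==suc b a) (==-sym b a)))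
           (solve 2 (λ d ι → (d :- ι) :* (:- con 1ℚ) := ι :+ (:- con 1ℚ) :* d) refl (indicator (a == b)) ι))) ⟩
    ι * 1ℚ + ∑[ a < r ] (ι + - 1ℚ * indicator (a == b))
      ≡⟨ cong (ι * 1ℚ +_) (∑-distrib-+ (λ _ → ι) (λ a → - 1ℚ * indicator (a == b))) ⟩
    ι * 1ℚ + (∑[ a < r ] ι + ∑[ a < r ] (- 1ℚ * indicator (a == b)))
      ≡⟨ cong₂ (λ x y → ι * 1ℚ + (x + y)) (sum-const r ι) (sum-δ r (λ _ → - 1ℚ) b) ⟩
    ι * 1ℚ + (ℕtoℚ r * ι + - 1ℚ)
      ≡⟨ solve 2 (λ ι r → ι :* con 1ℚ :+ (r :* ι :+ (:- con 1ℚ)) := (con 1ℚ :+ r) :* ι :+ (:- con 1ℚ)) refl ι (ℕtoℚ r) ⟩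
    (1ℚ + ℕtoℚ r) * ι + - 1ℚ
      ≡⟨ cong (λ x → x * ι + - 1ℚ) (ℕtoℚ-suc r) ⟨
    ℕtoℚ (suc r) * ι + - 1ℚ
      ≡⟨ cong (_+ - 1ℚ) qι≡1 ⟩
    1ℚ + - 1ℚ
      ≡⟨ ℚP.+-inverseʳ 1ℚ ⟩
    0ℚ ∎
    where open ≡-Reasoning
  dualCoeff-coordEigvec r ι qι≡1 b (Fin.suc x) = begin
    ι * 1ℚ + ∑[ a < r ] ((indicator (b == Fin.suc a) - ι) * indicator (a == x))
      ≡⟨ cong (ι * 1ℚ +_) (sum-δ r (λ a → indicator (b == Fin.suc a) - ι) x) ⟩
    ι * 1ℚ + (indicator (b == Fin.suc x) - ι)
      ≡⟨ solve 2 (λ ι d → ι :* con 1ℚ :+ (d :- ι) := d) refl ι (indicator (b == Fin.suc x)) ⟩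
    indicator (b == Fin.suc x) ∎
    where open ≡-Reasoning

  dualVec-eigvec : ∀ n r ι → ℕtoℚ (suc r) * ι ≡ 1ℚ → (u w : Vertex n (suc r)) →
                   sumV n (suc r) (λ t → dualVec ι u t * eigvec t w) ≡ indicator (vertexEq u w)
  dualVec-eigvec zero    r ι qι≡1 [] [] = refl
  dualVec-eigvec (suc n) r ι qι≡1 (b ∷ u) (x ∷ w) = begin
    sumV (suc n) q (λ t → dualVec ι (b ∷ u) t * eigvec t (x ∷ w))
      ≡⟨ sumV-∷ n q (λ t → dualVec ι (b ∷ u) t * eigvec t (x ∷ w)) ⟩
    ∑[ a < q ] sumV n q (λ t → (dualCoeff ι b a * dualVec ι u t) * (coordEigvec a x * eigvec t w))
      ≡⟨ sum-cong-≗ {q} (λ a → trans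
           (sumV-cong n q (λ t → solve 4 (λ g c f e → (g :* c) :* (f :* e) := c :* ((g :* f) :* e)) refl
              (dualCoeff ι b a) (dualVec ι u t) (coordEigvec a x) (eigvec t w)))
           (sumV-pull n q (dualVec ι u) (λ t → eigvec t w) (dualCoeff ι b a * coordEigvec a x))) ⟩
    ∑[ a < q ] ((dualCoeff ι b a * coordEigvec a x) * sumV n q (λ t → dualVec ι u t * eigvec t w))
      ≡⟨ sum-cong-≗ {q} (λ a → cong ((dualCoeff ι b a * coordEigvec a x) *_) (dualVec-eigvec n r ι qι≡1 u w)) ⟩
    ∑[ a < q ] ((dualCoeff ι b a * coordEigvec a x) * indicator (vertexEq u w))
      ≡⟨ *-distribʳ-sum {q} (indicator (vertexEq u w)) (λ a → dualCoeff ι b a * coordEigvec a x) ⟨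
    ∑[ a < q ] (dualCoeff ι b a * coordEigvec a x) * indicator (vertexEq u w)
      ≡⟨ cong (_* indicator (vertexEq u w)) (dualCoeff-coordEigvec r ι qι≡1 b x) ⟩
    indicator (b == x) * indicator (vertexEq u w)
      ≡⟨ indicator-∧ (b == x) (vertexEq u w) ⟨
    indicator ((b == x) ∧ vertexEq u w)
      ≡⟨ cong indicator (vertexEq-∷ b x u w) ⟨
    indicator (vertexEq (b ∷ u) (x ∷ w)) ∎
    where
    open ≡-Reasoning
    q = suc r

  sumV-δ : ∀ n q (v : Vertex n q) (x : Vertex n q → ℚ) → sumV n q (λ w → indicator (vertexEq v w) * x w) ≡ x v
  sumV-δ zero    q []      x = trans (ℚP.+-identityʳ _) (ℚP.*-identityˡ (x []))
  sumV-δ (suc n) q (b ∷ v) x = begin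
    sumV (suc n) q (λ w → indicator (vertexEq (b ∷ v) w) * x w)
      ≡⟨ sumV-∷ n q (λ w → indicator (vertexEq (b ∷ v) w) * x w) ⟩
    ∑[ y < q ] sumV n q (λ w → indicator (vertexEq (b ∷ v) (y ∷ w)) * x (y ∷ w))
      ≡⟨ sum-cong-≗ {q} (λ y → trans (sumV-cong n q (λ w → split y w))
           (trans (sumV-pull n q (λ w → indicator (vertexEq v w)) (λ w → x (y ∷ w)) (indicator (b == y)))
                  (cong (indicator (b == y) *_) (sumV-δ n q v (λ w → x (y ∷ w)))))) ⟩
    ∑[ y < q ] (indicator (b == y) * x (y ∷ v))
      ≡⟨ sum-cong-≗ {q} (λ y → trans (ℚP.*-comm (indicator (b == y)) (x (y ∷ v)))
                                     (cong (λ e → x (y ∷ v) * indicator e) (==-sym b y))) ⟩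
    ∑[ y < q ] (x (y ∷ v) * indicator (y == b))
      ≡⟨ sum-δ q (λ y → x (y ∷ v)) b ⟩
    x (b ∷ v) ∎
    where
    open ≡-Reasoning
    split : ∀ y w → indicator (vertexEq (b ∷ v) (y ∷ w)) * x (y ∷ w) ≡ indicator (vertexEq v w) * (indicator (b == y) * x (y ∷ w))
    split y w = begin
      indicator (vertexEq (b ∷ v) (y ∷ w)) * x (y ∷ w)
        ≡⟨ cong (λ e → indicator e * x (y ∷ w)) (vertexEq-∷ b y v w) ⟩
      indicator ((b == y) ∧ vertexEq v w) * x (y ∷ w)
        ≡⟨ cong (_* x (y ∷ w)) (indicator-∧ (b == y) (vertexEq v w)) ⟩
      indicator (b == y) * indicator (vertexEq v w) * x (y ∷ w)
        ≡⟨ solve 3 (λ a b c → (a :* b) :* c := b :* (a :* c)) refl (indicator (b == y)) (indicator (vertexEq v w)) (x (y ∷ w)) ⟩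
      indicator (vertexEq v w) * (indicator (b == y) * x (y ∷ w)) ∎

  -- Symmetric matrices with an eigenbasis

  coeffAlong : ∀ {A B : Set} (f : A → B) (g : A → ℚ) (xs : List A) → Fin (List.length (map f xs)) → ℚ
  coeffAlong f g (x ∷ xs) Fin.zero    = g x
  coeffAlong f g (x ∷ xs) (Fin.suc i) = coeffAlong f g xs i

  sum-coeffAlong : ∀ {A B : Set} (f : A → B) (g : A → ℚ) (h : B → ℚ) (xs : List A) →
    ∑[ i < List.length (map f xs) ] (coeffAlong f g xs i * h (List.lookup (map f xs) i)) ≡ sumℚ (map (λ x → g x * h (f x)) xs)
  sum-coeffAlong f g h []       = refl
  sum-coeffAlong f g h (x ∷ xs) = cong (g x * h (f x) +_) (sum-coeffAlong f g h xs)

  lookup-map-∀ : ∀ {A B : Set} (P : B → Set) (f : A → B) (xs : List A) → (∀ x → P (f x)) →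
                 ∀ i → P (List.lookup (map f xs) i)
  lookup-map-∀ P f (x ∷ xs) Pf Fin.zero    = Pf x
  lookup-map-∀ P f (x ∷ xs) Pf (Fin.suc i) = lookup-map-∀ P f xs Pf i

  module Eigenbasis {n q : ℕ} (A : Vertex n q → Vertex n q → ℚ) (A-sym : ∀ u w → A u w ≡ A w u)
    (val : Vertex n q → ℚ) (vec dual : Vertex n q → Vertex n q → ℚ)
    (eigen : ∀ t u → mulVec n q A (vec t) u ≡ val t * vec t u)
    (vec-nonzero : ∀ t → ∃ λ v → vec t v ≢ 0ℚ)
    (complete : ∀ u w → sumV n q (λ t → dual u t * vec t w) ≡ indicator (vertexEq u w))
    where

    ⟪_,_⟫ : (Vertex n q → ℚ) → (Vertex n q → ℚ) → ℚ
    ⟪ x , y ⟫ = sumV n q (λ w → x w * y w)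

    isEigenpair : ∀ t → IsEigenpair n q A (val t) (vec t)
    isEigenpair t = vec-nonzero t , eigen t

    diagonalisable : DiagonalisableOverℚ n q A
    diagonalisable =
      map pair (allVertices n q) ,
      lookup-map-∀ (λ (μ , x) → IsEigenpair n q A μ x) pair (allVertices n q) isEigenpair ,
      λ u → coeffAlong pair (dual u) (allVertices n q) , λ w →
        trans (sumℚ-allFin (List.length (map pair (allVertices n q))) _)
              (trans (sum-coeffAlong pair (dual u) (λ (_ , x) → x w) (allVertices n q)) (complete u w))
      where
      pair : Vertex n q → ℚ × (Vertex n q → ℚ)
      pair t = val t , vec t

    mulVec-self-adjoint : ∀ x y → ⟪ y , mulVec n q A x ⟫ ≡ ⟪ mulVec n q A y , x ⟫
    mulVec-self-adjoint x y = begin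
      sumV n q (λ u → y u * sumV n q (λ w → A u w * x w))
        ≡⟨ sumV-cong n q (λ u → sym (sumℚ-*ˡ (y u) (λ w → A u w * x w) (allVertices n q))) ⟩
      sumV n q (λ u → sumV n q (λ w → y u * (A u w * x w)))
        ≡⟨ sumℚ-swap (λ u w → y u * (A u w * x w)) (allVertices n q) (allVertices n q) ⟩
      sumV n q (λ w → sumV n q (λ u → y u * (A u w * x w)))
        ≡⟨ sumV-cong n q (λ w → trans
             (sumV-cong n q (λ u → trans (cong (λ a → y u * (a * x w)) (A-sym u w))
               (solve 3 (λ e a x → e :* (a :* x) := (a :* e) :* x) refl (y u) (A w u) (x w))))
             (sumℚ-*ʳ (x w) (λ u → A w u * y u) (allVertices n q))) ⟩
      sumV n q (λ w → mulVec n q A y w * x w) ∎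
      where open ≡-Reasoning

    eigenbasis-expansion : ∀ x v → x v ≡ sumV n q (λ t → dual v t * ⟪ vec t , x ⟫)
    eigenbasis-expansion x v = begin
      x v
        ≡⟨ sumV-δ n q v x ⟨
      sumV n q (λ w → indicator (vertexEq v w) * x w)
        ≡⟨ sumV-cong n q (λ w → cong (_* x w) (complete v w)) ⟨
      sumV n q (λ w → sumV n q (λ t → dual v t * vec t w) * x w)
        ≡⟨ sumV-cong n q (λ w → trans (sym (sumℚ-*ʳ (x w) (λ t → dual v t * vec t w) (allVertices n q)))
             (sumV-cong n q (λ t → ℚP.*-assoc (dual v t) (vec t w) (x w)))) ⟩
      sumV n q (λ w → sumV n q (λ t → dual v t * (vec t w * x w)))
        ≡⟨ sumℚ-swap (λ w t → dual v t * (vec t w * x w)) (allVertices n q) (allVertices n q) ⟩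
      sumV n q (λ t → sumV n q (λ w → dual v t * (vec t w * x w)))
        ≡⟨ sumV-cong n q (λ t → sumℚ-*ˡ (dual v t) (λ w → vec t w * x w) (allVertices n q)) ⟩
      sumV n q (λ t → dual v t * ⟪ vec t , x ⟫) ∎
      where open ≡-Reasoning

    ⟪vec,x⟫≡0 : ∀ {μ x} → (∀ u → mulVec n q A x u ≡ μ * x u) → ∀ t → val t ≢ μ → ⟪ vec t , x ⟫ ≡ 0ℚ
    ⟪vec,x⟫≡0 {μ} {x} Ax≡μx t val≢μ = *-cancelˡ-≢0 (val t - μ) val-μ≢0 (begin
      (val t - μ) * ⟪ vec t , x ⟫                  ≡⟨ ℚP.*-distribʳ-+ ⟪ vec t , x ⟫ (val t) (- μ) ⟩
      val t * ⟪ vec t , x ⟫ + - μ * ⟪ vec t , x ⟫   ≡⟨ cong₂ _+_ (sym λ-side) (sym (ℚP.neg-distribˡ-* μ _)) ⟩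
      ⟪ mulVec n q A (vec t) , x ⟫ + - (μ * ⟪ vec t , x ⟫)
                                                    ≡⟨ cong (λ s → s + - (μ * ⟪ vec t , x ⟫)) (trans (sym (mulVec-self-adjoint x (vec t))) μ-side) ⟩
      μ * ⟪ vec t , x ⟫ + - (μ * ⟪ vec t , x ⟫)     ≡⟨ ℚP.+-inverseʳ (μ * ⟪ vec t , x ⟫) ⟩
      0ℚ                                            ≡⟨ ℚP.*-zeroʳ (val t - μ) ⟨
      (val t - μ) * 0ℚ                              ∎)
      where
      open ≡-Reasoning
      val-μ≢0 : val t - μ ≢ 0ℚ
      val-μ≢0 eq = val≢μ (trans (sym (solve 2 (λ a b → (a :- b) :+ b := a) refl (val t) μ))
                                (trans (cong (_+ μ) eq) (ℚP.+-identityˡ μ)))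
      λ-side : ⟪ mulVec n q A (vec t) , x ⟫ ≡ val t * ⟪ vec t , x ⟫
      λ-side = trans (sumV-cong n q (λ w → trans (cong (_* x w) (eigen t w)) (ℚP.*-assoc (val t) (vec t w) (x w))))
                     (sumℚ-*ˡ (val t) (λ w → vec t w * x w) (allVertices n q))
      μ-side : ⟪ vec t , mulVec n q A x ⟫ ≡ μ * ⟪ vec t , x ⟫
      μ-side = trans (sumV-cong n q (λ u → trans (cong (vec t u *_) (Ax≡μx u))
                       (solve 3 (λ e m x → e :* (m :* x) := m :* (e :* x)) refl (vec t u) μ (x u))))
                     (sumℚ-*ˡ μ (λ u → vec t u * x u) (allVertices n q))

    eigenvalue-in-basis : ∀ μ → IsEigenvalue n q A μ → ∃ λ t → μ ≡ val t
    eigenvalue-in-basis μ (x , (v , xv≢0) , Ax≡μx) with any? (λ t → val t ℚP.≟ μ) (allVertices n q)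
    ... | yes some = let t , val≡μ = satisfied some in t , sym val≡μ
    ... | no none  = ⊥-elim (xv≢0 (begin
      x v                                         ≡⟨ eigenbasis-expansion x v ⟩
      sumV n q (λ t → dual v t * ⟪ vec t , x ⟫)    ≡⟨ sumℚ-zero (allVertices n q) (λ t →
                                                        trans (cong (dual v t *_) (⟪vec,x⟫≡0 Ax≡μx t (λ e → none (lose (∈-allVertices t) e))))
                                                              (ℚP.*-zeroʳ (dual v t))) ⟩
      0ℚ                                          ∎))
      where open ≡-Reasoning

  -- The procedure

  get≡lookup : ∀ {n} (a : Arr n) {k} (k<1+n : k ℕ.< suc n) → get a k ≡ Vec.lookup a (Fin.fromℕ< k<1+n)
  get≡lookup {n} a {k} k<1+n with k ℕ.<? suc n
  ... | yes _  = refl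
  ... | no k≮ = ⊥-elim (k≮ k<1+n)

  get-set : ∀ {n} (a : Arr n) {k} x → k ℕ.≤ n → get (set a k x) k ≡ x
  get-set {n} a {k} x k≤n with k ℕ.<? suc n
  ... | yes k<1+n = VecP.lookup∘updateAt (Fin.fromℕ< k<1+n) a
  ... | no  k≮    = ⊥-elim (k≮ (ℕ.s≤s k≤n))

  get-set-≢ : ∀ {n} (a : Arr n) {k} x {j} → j ≢ k → get (set a k x) j ≡ get a j
  get-set-≢ {n} a {k} x {j} j≢k with k ℕ.<? suc n
  ... | no _ = refl
  ... | yes k< with j ℕ.<? suc n
  ...   | no _   = refl
  ...   | yes j< = VecP.lookup∘updateAt′ (Fin.fromℕ< j<) (Fin.fromℕ< k<) (j≢k ∘ FinP.fromℕ<-injective j k j< k<) a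

  get-zipWith : ∀ {n} (a b : Arr n) {j} → j ℕ.≤ n → get (Vec.zipWith _+_ a b) j ≡ get a j + get b j
  get-zipWith a b j≤n rewrite get≡lookup (Vec.zipWith _+_ a b) (ℕ.s≤s j≤n)
                            | get≡lookup a (ℕ.s≤s j≤n) | get≡lookup b (ℕ.s≤s j≤n) =
    VecP.lookup-zipWith _+_ _ a b

  get-replicate : ∀ {n} x {j} → j ℕ.≤ n → get (Vec.replicate (suc n) x) j ≡ x
  get-replicate {n} x j≤n = trans (get≡lookup _ (ℕ.s≤s j≤n)) (VecP.lookup-replicate (Fin.fromℕ< (ℕ.s≤s j≤n)) x)

  stepAValue : (n q i j : ℕ) → ℚ → ℚ → ℚ
  stepAValue n q i j x y = ((ℕtoℚ n - ℕtoℚ j - ℕtoℚ i + 1ℚ) * ℕtoℚ (q ℕ.∸ 1)) ÷' ℕtoℚ i * x - (ℕtoℚ j ÷' ℕtoℚ i) * y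

  stepA-steps : ∀ n q i k a → proj₂ (stepA n q i k a) ≡ k
  stepA-steps n q i zero    a = refl
  stepA-steps n q i (suc k) a = cong suc (stepA-steps n q i k _)

  stepA-untouched : ∀ n q i k a j → j ≡ 0 ⊎ k ℕ.< j → get (proj₁ (stepA n q i k a)) j ≡ get a j
  stepA-untouched n q i zero    a j _ = refl
  stepA-untouched n q i (suc k) a j j≡0⊎k<j =
    trans (stepA-untouched n q i k _ j (Data.Sum.map₂ (ℕP.<-trans (ℕP.n<1+n k)) j≡0⊎k<j))
          (get-set-≢ a _ (j≢1+k j≡0⊎k<j))
    where
    j≢1+k : j ≡ 0 ⊎ suc k ℕ.< j → j ≢ suc k
    j≢1+k (inj₁ j≡0)   j≡1+k = ℕP.1+n≢0 (trans (sym j≡1+k) j≡0)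
    j≢1+k (inj₂ 1+k<j) j≡1+k = ℕP.<-irrefl (sym j≡1+k) 1+k<j

  -- Step (a) runs downwards, so when krav[j] is overwritten krav[j - 1] still holds its old value.
  stepA-updated : ∀ n q i k a j → k ℕ.≤ n → 1 ℕ.≤ j → j ℕ.≤ k →
                  get (proj₁ (stepA n q i k a)) j ≡ stepAValue n q i j (get a j) (get a (ℕ.pred j))
  stepA-updated n q i zero    a j _ 1≤j j≤0 = ⊥-elim (ℕP.<-irrefl refl (ℕP.≤-trans 1≤j j≤0))
  stepA-updated n q i (suc k) a j 1+k≤n 1≤j j≤1+k with ℕP.m≤n⇒m<n∨m≡n j≤1+k
  ... | inj₂ refl =
    trans (stepA-untouched n q i k _ (suc k) (inj₂ (ℕP.n<1+n k))) (get-set a _ 1+k≤n)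
  ... | inj₁ j<1+k =
    trans (stepA-updated n q i k _ j (ℕP.<⇒≤ 1+k≤n) 1≤j (ℕP.≤-pred j<1+k))
          (cong₂ (stepAValue n q i j) (get-set-≢ a _ (ℕP.<⇒≢ j<1+k))
                                       (get-set-≢ a _ (ℕP.<⇒≢ (ℕP.≤-<-trans ℕP.pred[n]≤n j<1+k))))

  ÷'-clear : ∀ d a b x y → d ≢ 0ℚ → d * ((a ÷' d) * x - (b ÷' d) * y) ≡ a * x - b * y
  ÷'-clear d a b x y d≢0 = begin
    d * ((a ÷' d) * x - (b ÷' d) * y)        ≡⟨ solve 5 (λ d a′ b′ x y → d :* (a′ :* x :- b′ :* y) := (d :* a′) :* x :- (d :* b′) :* y)
                                                  refl d (a ÷' d) (b ÷' d) x y ⟩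
    (d * (a ÷' d)) * x - (d * (b ÷' d)) * y  ≡⟨ cong₂ (λ a′ b′ → a′ * x - b′ * y) (*-÷'-cancel a d d≢0) (*-÷'-cancel b d d≢0) ⟩
    a * x - b * y                            ∎
    where open ≡-Reasoning

  krawtchouk : ℕ → ℕ → ℕ → ℕ → ℚ
  krawtchouk n q i j = kraw (ℕtoℚ (q ℕ.∸ 1)) (n ℕ.∸ j) j i

  stepAValue-krawtchouk : ∀ n q i j → 1 ℕ.≤ j → j ℕ.≤ n →
    stepAValue n q (suc i) j (krawtchouk n q i j) (krawtchouk n q i (ℕ.pred j)) ≡ krawtchouk n q (suc i) j
  stepAValue-krawtchouk n q i (suc j) _ 1+j≤n = *-cancelˡ-≢0 (ℕtoℚ (suc i)) (ℕtoℚ-suc≢0 i) (begin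
    ℕtoℚ (suc i) * stepAValue n q (suc i) (suc j) (kraw c m (suc j) i) (kraw c (n ℕ.∸ j) j i)
      ≡⟨ ÷'-clear (ℕtoℚ (suc i)) _ (ℕtoℚ (suc j)) _ _ (ℕtoℚ-suc≢0 i) ⟩
    (ℕtoℚ n - ℕtoℚ (suc j) - ℕtoℚ (suc i) + 1ℚ) * c * kraw c m (suc j) i - ℕtoℚ (suc j) * kraw c (n ℕ.∸ j) j i
      ≡⟨ cong₂ (λ a b → a * c * kraw c m (suc j) i - ℕtoℚ (suc j) * kraw c b j i) coefficient n∸j≡1+m ⟩
    (ℕtoℚ m - ℕtoℚ i) * c * kraw c m (suc j) i - ℕtoℚ (suc j) * kraw c (suc m) j i
      ≡⟨ kraw-recurrence c m (suc j) i ⟨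
    ℕtoℚ (suc i) * kraw c m (suc j) (suc i) ∎)
    where
    open ≡-Reasoning
    c = ℕtoℚ (q ℕ.∸ 1)
    m = n ℕ.∸ suc j
    n∸j≡1+m : n ℕ.∸ j ≡ suc m
    n∸j≡1+m = ℕP.+-∸-assoc 1 1+j≤n
    n≡m+1+j : ℕtoℚ n ≡ ℕtoℚ m + ℕtoℚ (suc j)
    n≡m+1+j = trans (cong ℕtoℚ (sym (ℕP.m∸n+n≡m 1+j≤n))) (ℕtoℚ-+ m (suc j))
    coefficient : ℕtoℚ n - ℕtoℚ (suc j) - ℕtoℚ (suc i) + 1ℚ ≡ ℕtoℚ m - ℕtoℚ i
    coefficient rewrite n≡m+1+j | ℕtoℚ-suc i =
      solve 3 (λ m j i → m :+ j :- j :- (con 1ℚ :+ i) :+ con 1ℚ := m :- i) refl (ℕtoℚ m) (ℕtoℚ (suc j)) (ℕtoℚ i)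

  stepBValue-krawtchouk : ∀ n q i →
    (((ℕtoℚ n - ℕtoℚ (suc i) + 1ℚ) * ℕtoℚ (q ℕ.∸ 1)) ÷' ℕtoℚ (suc i)) * krawtchouk n q i 0 ≡ krawtchouk n q (suc i) 0
  stepBValue-krawtchouk n q i = *-cancelˡ-≢0 (ℕtoℚ (suc i)) (ℕtoℚ-suc≢0 i) (begin
    ℕtoℚ (suc i) * ((a ÷' ℕtoℚ (suc i)) * kraw c n 0 i)
      ≡⟨ solve 3 (λ d a′ x → d :* (a′ :* x) := (d :* a′) :* x) refl (ℕtoℚ (suc i)) (a ÷' ℕtoℚ (suc i)) (kraw c n 0 i) ⟩
    (ℕtoℚ (suc i) * (a ÷' ℕtoℚ (suc i))) * kraw c n 0 i
      ≡⟨ cong (_* kraw c n 0 i) (*-÷'-cancel a (ℕtoℚ (suc i)) (ℕtoℚ-suc≢0 i)) ⟩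
    (ℕtoℚ n - ℕtoℚ (suc i) + 1ℚ) * c * kraw c n 0 i
      ≡⟨ cong (λ b → b * c * kraw c n 0 i) coefficient ⟩
    (ℕtoℚ n - ℕtoℚ i) * c * kraw c n 0 i
      ≡⟨ solve 2 (λ x y → x := x :- con 0ℚ :* y) refl ((ℕtoℚ n - ℕtoℚ i) * c * kraw c n 0 i) (kraw c (suc n) 0 i) ⟩
    (ℕtoℚ n - ℕtoℚ i) * c * kraw c n 0 i - ℕtoℚ 0 * kraw c (suc n) 0 i
      ≡⟨ kraw-recurrence c n 0 i ⟨
    ℕtoℚ (suc i) * kraw c n 0 (suc i) ∎)
    where
    open ≡-Reasoning
    c = ℕtoℚ (q ℕ.∸ 1)
    a = (ℕtoℚ n - ℕtoℚ (suc i) + 1ℚ) * c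
    coefficient : ℕtoℚ n - ℕtoℚ (suc i) + 1ℚ ≡ ℕtoℚ n - ℕtoℚ i
    coefficient rewrite ℕtoℚ-suc i = solve 2 (λ n i → n :- (con 1ℚ :+ i) :+ con 1ℚ := n :- i) refl (ℕtoℚ n) (ℕtoℚ i)

  KravInvariant : (n q i : ℕ) → Arr n × Arr n × ℕ → Set
  KravInvariant n q i (krav , lam , _) =
    ∀ j → j ℕ.≤ n → get krav j ≡ krawtchouk n q i j × get lam j ≡ sumTo i (λ I → krawtchouk n q I j)

  initState-invariant : ∀ n q → KravInvariant n q 0 (initState n)
  initState-invariant n q j j≤n =
    trans (get-replicate 1ℚ j≤n) (sym (kraw-head _ (n ℕ.∸ j) j)) , get-replicate 0ℚ j≤n

  iteration-invariant : ∀ n q i st → KravInvariant n q i st → KravInvariant n q (suc i) (iteration n q (suc i) st)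
  iteration-invariant n q i (krav , lam , s) inv j j≤n = krav′≡ j j≤n , lam′≡
    where
    afterA = proj₁ (stepA n q (suc i) n krav)
    krav′ = proj₁ (stepB n q (suc i) afterA)
    krav′≡ : ∀ j → j ℕ.≤ n → get krav′ j ≡ krawtchouk n q (suc i) j
    krav′≡ zero _ = begin
      get krav′ 0                   ≡⟨ get-set afterA _ ℕ.z≤n ⟩
      b * get afterA 0              ≡⟨ cong (b *_) (trans (stepA-untouched n q (suc i) n krav 0 (inj₁ refl)) (proj₁ (inv 0 ℕ.z≤n))) ⟩
      b * krawtchouk n q i 0        ≡⟨ stepBValue-krawtchouk n q i ⟩
      krawtchouk n q (suc i) 0      ∎
      where
      open ≡-Reasoning
      b = ((ℕtoℚ n - ℕtoℚ (suc i) + 1ℚ) * ℕtoℚ (q ℕ.∸ 1)) ÷' ℕtoℚ (suc i)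
    krav′≡ (suc j) 1+j≤n = begin
      get krav′ (suc j)             ≡⟨ get-set-≢ afterA {0} _ {suc j} (λ ()) ⟩
      get afterA (suc j)            ≡⟨ stepA-updated n q (suc i) n krav (suc j) ℕP.≤-refl (ℕ.s≤s ℕ.z≤n) 1+j≤n ⟩
      stepAValue n q (suc i) (suc j) (get krav (suc j)) (get krav j)
                                    ≡⟨ cong₂ (stepAValue n q (suc i) (suc j)) (proj₁ (inv (suc j) 1+j≤n)) (proj₁ (inv j (ℕP.<⇒≤ 1+j≤n))) ⟩
      stepAValue n q (suc i) (suc j) (krawtchouk n q i (suc j)) (krawtchouk n q i j)
                                    ≡⟨ stepAValue-krawtchouk n q i (suc j) (ℕ.s≤s ℕ.z≤n) 1+j≤n ⟩
      krawtchouk n q (suc i) (suc j) ∎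
      where open ≡-Reasoning
    lam′≡ : get (Vec.zipWith _+_ lam krav′) j ≡ sumTo (suc i) (λ I → krawtchouk n q I j)
    lam′≡ = trans (get-zipWith lam krav′ j≤n) (cong₂ _+_ (proj₂ (inv j j≤n)) (krav′≡ j j≤n))

  loop-invariant : ∀ n q p i st → KravInvariant n q i st → KravInvariant n q (i ℕ.+ p) (loop n q (suc i) p st)
  loop-invariant n q zero    i st inv = subst (λ k → KravInvariant n q k st) (sym (ℕP.+-identityʳ i)) inv
  loop-invariant n q (suc p) i st inv =
    subst (λ k → KravInvariant n q k (loop n q (suc (suc i)) p (iteration n q (suc i) st))) (sym (ℕP.+-suc i p))
          (loop-invariant n q p (suc i) (iteration n q (suc i) st) (iteration-invariant n q i st inv))

  lambdaArr≡krawtchoukSum : ∀ n q p j → j ℕ.≤ n → get (lambdaArr n q p) j ≡ sumTo p (λ I → krawtchouk n q I j)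
  lambdaArr≡krawtchoukSum n q p j j≤n = proj₂ (loop-invariant n q p 0 (initState n) (initState-invariant n q) j j≤n)

  loop-steps : ∀ n q p i krav lam s →
               proj₂ (proj₂ (loop n q i p (krav , lam , s))) ≡ s ℕ.+ p ℕ.* (n ℕ.+ 1 ℕ.+ suc (suc n))
  loop-steps n q zero    i krav lam s = sym (ℕP.+-identityʳ s)
  loop-steps n q (suc p) i krav lam s = begin
    proj₂ (proj₂ (loop n q (suc i) p (iteration n q i (krav , lam , s))))
      ≡⟨ loop-steps n q p (suc i) _ _ _ ⟩
    s ℕ.+ proj₂ (stepA n q i n krav) ℕ.+ 1 ℕ.+ suc (suc n) ℕ.+ p ℕ.* (n ℕ.+ 1 ℕ.+ suc (suc n))
      ≡⟨ cong (λ a → s ℕ.+ a ℕ.+ 1 ℕ.+ suc (suc n) ℕ.+ p ℕ.* (n ℕ.+ 1 ℕ.+ suc (suc n))) (stepA-steps n q i n krav) ⟩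
    s ℕ.+ n ℕ.+ 1 ℕ.+ suc (suc n) ℕ.+ p ℕ.* (n ℕ.+ 1 ℕ.+ suc (suc n))
      ≡⟨ rearrange s n p ⟩
    s ℕ.+ suc p ℕ.* (n ℕ.+ 1 ℕ.+ suc (suc n)) ∎
    where
    open ≡-Reasoning
    rearrange : ∀ s n p → s ℕ.+ n ℕ.+ 1 ℕ.+ suc (suc n) ℕ.+ p ℕ.* (n ℕ.+ 1 ℕ.+ suc (suc n)) ≡ s ℕ.+ suc p ℕ.* (n ℕ.+ 1 ℕ.+ suc (suc n))
    rearrange = NatSolver.solve-∀

  foldr-⊓-≤-init : ∀ y (zs : List ℚ) → List.foldr ℚ._⊓_ y zs ℚ.≤ y
  foldr-⊓-≤-init y []       = ℚP.≤-refl
  foldr-⊓-≤-init y (z ∷ zs) = ℚP.≤-trans (ℚP.p⊓q≤q z _) (foldr-⊓-≤-init y zs)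

  foldr-⊓-≤-∈ : ∀ y (zs : List ℚ) {z} → z ∈ zs → List.foldr ℚ._⊓_ y zs ℚ.≤ z
  foldr-⊓-≤-∈ y (z ∷ zs) (here refl) = ℚP.p⊓q≤p z _
  foldr-⊓-≤-∈ y (z ∷ zs) (there z∈) = ℚP.≤-trans (ℚP.p⊓q≤q z _) (foldr-⊓-≤-∈ y zs z∈)

  foldr-⊓-sel : ∀ y (zs : List ℚ) → List.foldr ℚ._⊓_ y zs ≡ y ⊎ List.foldr ℚ._⊓_ y zs ∈ zs
  foldr-⊓-sel y []       = inj₁ refl
  foldr-⊓-sel y (z ∷ zs) with ℚP.⊓-sel z (List.foldr ℚ._⊓_ y zs)
  ... | inj₁ ≡z = inj₂ (here ≡z)
  ... | inj₂ ≡rest with foldr-⊓-sel y zs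
  ...   | inj₁ ≡y  = inj₁ (trans ≡rest ≡y)
  ...   | inj₂ ∈zs = inj₂ (there (subst (_∈ zs) (sym ≡rest) ∈zs))

  ∈-toList⇒lookup : ∀ {m} (ys : Vec ℚ m) {z} → z ∈ Vec.toList ys → ∃ λ i → z ≡ Vec.lookup ys i
  ∈-toList⇒lookup (y ∷ ys) (here z≡y) = Fin.zero , z≡y
  ∈-toList⇒lookup (y ∷ ys) (there z∈) with ∈-toList⇒lookup ys z∈
  ... | i , z≡ = Fin.suc i , z≡

  minTail : ∀ {n} → Arr n → ℚ
  minTail a = minList (Vec.toList (Vec.tail a))

  minTail-≤ : ∀ {n} (a : Arr (suc n)) {k} → 1 ℕ.≤ k → k ℕ.≤ suc n → minTail a ℚ.≤ get a k
  minTail-≤ (x ∷ y ∷ ys) {suc zero}    _ _ = foldr-⊓-≤-init y (Vec.toList ys)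
  minTail-≤ (x ∷ y ∷ ys) {suc (suc k)} _ (ℕ.s≤s k<n) =
    ℚP.≤-trans (foldr-⊓-≤-∈ y (Vec.toList ys) (∈-toList⁺ (∈-lookup (Fin.fromℕ< k<n) ys)))
               (ℚP.≤-reflexive (sym (get≡lookup (x ∷ y ∷ ys) (ℕ.s≤s (ℕ.s≤s k<n)))))

  minTail-attained : ∀ {n} (a : Arr (suc n)) → ∃ λ k → 1 ℕ.≤ k × k ℕ.≤ suc n × minTail a ≡ get a k
  minTail-attained (x ∷ y ∷ ys) with foldr-⊓-sel y (Vec.toList ys)
  ... | inj₁ ≡y  = 1 , ℕ.s≤s ℕ.z≤n , ℕ.s≤s ℕ.z≤n , ≡y
  ... | inj₂ ∈ys with ∈-toList⇒lookup ys ∈ys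
  ...   | i , ≡yᵢ = suc (suc (Fin.toℕ i)) , ℕ.s≤s ℕ.z≤n , ℕ.s≤s (FinP.toℕ<n i) ,
    trans ≡yᵢ (sym (trans (get≡lookup (x ∷ y ∷ ys) (ℕ.s≤s (ℕ.s≤s (FinP.toℕ<n i))))
                          (cong (Vec.lookup ys) (FinP.fromℕ<-toℕ i (FinP.toℕ<n i)))))

  -- The spectrum of H(n, q)ᵖ

  weightVertex : ∀ {r} n → ℕ → Vertex n (suc (suc r))
  weightVertex zero    _       = []
  weightVertex (suc n) zero    = Fin.zero ∷ weightVertex n zero
  weightVertex (suc n) (suc k) = Fin.suc Fin.zero ∷ weightVertex n k

  weight-weightVertex : ∀ {r} n {k} → k ℕ.≤ n → weight (weightVertex {r} n k) ≡ k
  weight-weightVertex zero    ℕ.z≤n       = refl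
  weight-weightVertex (suc n) ℕ.z≤n       = weight-weightVertex n ℕ.z≤n
  weight-weightVertex (suc n) (ℕ.s≤s k≤n) = cong suc (weight-weightVertex n k≤n)

  module PowerGraph (n′ r′ p : ℕ) where
    n = suc n′
    r = suc r′
    q = suc r
    A = adjMatrix n q p
    Λ = lambdaArr n q p

    eigenvalue : Vertex n q → ℚ
    eigenvalue = powerEigenvalue p (ℕtoℚ r)

    eigenvalue≡lambdaArr : ∀ t → eigenvalue t ≡ get Λ (weight t)
    eigenvalue≡lambdaArr t = begin
      sumTo p (eigenSeries (ℕtoℚ r) t)                        ≡⟨ sumTo-cong p (λ i → eigenSeries≡kraw (ℕtoℚ r) t (suc i)) ⟩
      sumTo p (λ i → kraw (ℕtoℚ r) (zeroCount t) (weight t) i) ≡⟨ cong (λ m → sumTo p (λ i → kraw (ℕtoℚ r) m (weight t) i)) zeroCount≡ ⟩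
      sumTo p (λ i → krawtchouk n q i (weight t))              ≡⟨ lambdaArr≡krawtchoukSum n q p (weight t) (weight≤n t) ⟨
      get Λ (weight t)                                         ∎
      where
      open ≡-Reasoning
      zeroCount≡ : zeroCount t ≡ n ℕ.∸ weight t
      zeroCount≡ = trans (sym (ℕP.m+n∸n≡m (zeroCount t) (weight t))) (cong (ℕ._∸ weight t) (zeroCount+weight t))

    open Eigenbasis A (adjMatrix-sym n q p) eigenvalue eigvec (dualVec (1ℚ ÷' ℕtoℚ q))
      (adjMatrix-eigvec n r p)
      (λ t → t , λ eq → ℚP.<-irrefl (trans (sym eq) (eigvec-diagonal t)) (0<ℕtoℚ-suc 0))
      (dualVec-eigvec n r (1ℚ ÷' ℕtoℚ q) (*-÷'-cancel 1ℚ (ℕtoℚ q) (ℕtoℚ-suc≢0 r)))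
      public

    isEigenvalue : ∀ t → IsEigenvalue n q A (eigenvalue t)
    isEigenvalue t = eigvec t , isEigenpair t

    eigenvalue≤zeros : ∀ t → eigenvalue t ℚ.≤ eigenvalue (zeros n)
    eigenvalue≤zeros = powerEigenvalue≤zeros (ℕtoℚ r) (1≤ℕtoℚ-suc r′) p

    procLambdaMax≡ : procLambdaMax n q p ≡ eigenvalue (zeros n)
    procLambdaMax≡ = sym (trans (eigenvalue≡lambdaArr (zeros n)) (cong (get Λ) (weight-zeros n)))

    largest : IsLargestEigenvalue n q A (procLambdaMax n q p)
    largest = subst (IsEigenvalue n q A) (sym procLambdaMax≡) (isEigenvalue (zeros n)) ,
              λ μ μ-eig → let t , μ≡ = eigenvalue-in-basis μ μ-eig in
                subst₂ ℚ._≤_ (sym μ≡) (sym procLambdaMax≡) (eigenvalue≤zeros t)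

    procLambdaMin-attained : ∃ λ t → procLambdaMin n q p ≡ eigenvalue t
    procLambdaMin-attained with minTail-attained Λ
    ... | k , _ , k≤n , min≡ =
      weightVertex n k , trans min≡ (trans (cong (get Λ) (sym (weight-weightVertex n k≤n)))
                                           (sym (eigenvalue≡lambdaArr (weightVertex n k))))

    procLambdaMin≤ : ∀ t → procLambdaMin n q p ℚ.≤ eigenvalue t
    procLambdaMin≤ t with weight t in weight≡ | eigenvalue≡lambdaArr t
    ... | zero  | λt≡ = begin
      procLambdaMin n q p        ≡⟨ proj₂ procLambdaMin-attained ⟩
      eigenvalue tₘᵢₙ            ≤⟨ eigenvalue≤zeros tₘᵢₙ ⟩
      eigenvalue (zeros n)       ≡⟨ procLambdaMax≡ ⟨
      get Λ 0                    ≡⟨ λt≡ ⟨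
      eigenvalue t               ∎
      where
      open ℚP.≤-Reasoning
      tₘᵢₙ = proj₁ procLambdaMin-attained
    ... | suc w | λt≡ =
      ℚP.≤-trans (minTail-≤ Λ (ℕ.s≤s ℕ.z≤n) (subst (ℕ._≤ n) weight≡ (weight≤n t))) (ℚP.≤-reflexive (sym λt≡))

    smallest : IsSmallestEigenvalue n q A (procLambdaMin n q p)
    smallest = let t , min≡ = procLambdaMin-attained in
               subst (IsEigenvalue n q A) (sym min≡) (isEigenvalue t) ,
               λ μ μ-eig → let t , μ≡ = eigenvalue-in-basis μ μ-eig in
                 subst (procLambdaMin n q p ℚ.≤_) (sym μ≡) (procLambdaMin≤ t)

    procLambdaMin<0 : 1 ℕ.≤ p → procLambdaMin n q p ℚ.< 0ℚ
    procLambdaMin<0 (ℕ.s≤s {n = p′} _) = ℚP.≰⇒> λ 0≤min → ℚP.<-irrefl refl (begin-strict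
      0ℚ                     <⟨ powerEigenvalue-zeros-pos n′ (ℕtoℚ r) (0<ℕtoℚ-suc r′) p′ ⟩
      eigenvalue (zeros n)   ≤⟨ ∈⇒≤-sumℚ eigenvalue (λ t → ℚP.≤-trans 0≤min (procLambdaMin≤ t)) (∈-allVertices (zeros n)) ⟩
      sumV n q eigenvalue    ≡⟨ sumV-powerEigenvalue n r p ⟩
      0ℚ                     ∎)
      where open ℚP.≤-Reasoning

    procOutput≡hoffman : 1 ℕ.≤ p → procOutput n q p ≡ hoffman (procLambdaMax n q p) (procLambdaMin n q p)
    procOutput≡hoffman 1≤p = cong (λ m → 1ℚ + (procLambdaMax n q p ÷' m)) (sym ∣min∣≡-min)
      where
      ∣min∣≡-min : ℚ.∣ procLambdaMin n q p ∣ ≡ - procLambdaMin n q p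
      ∣min∣≡-min with ℚP.∣p∣≡p∨∣p∣≡-p (procLambdaMin n q p)
      ... | inj₂ ∣m∣≡-m = ∣m∣≡-m
      ... | inj₁ ∣m∣≡m  = ⊥-elim (ℚP.<-irrefl refl (ℚP.<-≤-trans (procLambdaMin<0 1≤p)
                                    (subst (0ℚ ℚ.≤_) ∣m∣≡m (ℚP.0≤∣p∣ (procLambdaMin n q p)))))

  procedure-correct : (n q p : ℕ) → 1 ℕ.≤ n → 2 ℕ.≤ q → 1 ℕ.≤ p → p ℕ.≤ n →
    DiagonalisableOverℚ n q (adjMatrix n q p)
    × IsLargestEigenvalue n q (adjMatrix n q p) (procLambdaMax n q p)
    × IsSmallestEigenvalue n q (adjMatrix n q p) (procLambdaMin n q p)
    × procLambdaMin n q p ℚ.< 0ℚ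
    × procOutput n q p ≡ hoffman (procLambdaMax n q p) (procLambdaMin n q p)
  procedure-correct zero     q               p ()
  procedure-correct (suc n′) zero            p _ ()
  procedure-correct (suc n′) (suc zero)      p _ (ℕ.s≤s ())
  procedure-correct (suc n′) (suc (suc r′)) p _ _ 1≤p _ =
    diagonalisable , largest , smallest , procLambdaMin<0 1≤p , procOutput≡hoffman 1≤p
    where open PowerGraph n′ r′ p

  procSteps-bound : (n q p : ℕ) → 1 ℕ.≤ n → 1 ℕ.≤ p → procSteps n q p ℕ.≤ 12 ℕ.* n ℕ.* p
  procSteps-bound (suc n′) q (suc p′) _ _ = begin
    procSteps (suc n′) q (suc p′)
      ≡⟨ cong (λ s → s ℕ.+ 1 ℕ.+ suc n′ ℕ.+ 1) (loop-steps (suc n′) q (suc p′) 1 _ _ (suc (suc n′) ℕ.+ suc (suc n′))) ⟩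
    steps
      ≤⟨ ℕP.m≤m+n steps (10 ℕ.* n′ ℕ.* p′ ℕ.+ 7 ℕ.* n′ ℕ.+ 7 ℕ.* p′) ⟩
    steps ℕ.+ (10 ℕ.* n′ ℕ.* p′ ℕ.+ 7 ℕ.* n′ ℕ.+ 7 ℕ.* p′)
      ≡⟨ slack n′ p′ ⟩
    12 ℕ.* suc n′ ℕ.* suc p′ ∎
    where
    open ℕP.≤-Reasoning
    steps = suc (suc n′) ℕ.+ suc (suc n′) ℕ.+ suc p′ ℕ.* (suc n′ ℕ.+ 1 ℕ.+ suc (suc (suc n′))) ℕ.+ 1 ℕ.+ suc n′ ℕ.+ 1
    slack : ∀ n′ p′ → suc (suc n′) ℕ.+ suc (suc n′) ℕ.+ suc p′ ℕ.* (suc n′ ℕ.+ 1 ℕ.+ suc (suc (suc n′))) ℕ.+ 1 ℕ.+ suc n′ ℕ.+ 1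
                      ℕ.+ (10 ℕ.* n′ ℕ.* p′ ℕ.+ 7 ℕ.* n′ ℕ.+ 7 ℕ.* p′) ≡ 12 ℕ.* suc n′ ℕ.* suc p′
    slack = NatSolver.solve-∀

  procSpace-bound : (n q p : ℕ) → 1 ℕ.≤ n → procSpace n q p ℕ.≤ 4 ℕ.* n
  procSpace-bound (suc n′) q p _ =
    ℕP.≤-trans (ℕP.m≤m+n (suc (suc n′) ℕ.+ suc (suc n′)) (2 ℕ.* n′)) (ℕP.≤-reflexive (slack n′))
    where
    slack : ∀ n′ → suc (suc n′) ℕ.+ suc (suc n′) ℕ.+ 2 ℕ.* n′ ≡ 4 ℕ.* suc n′
    slack = NatSolver.solve-∀

open HammingPowerSpectrum using (procedure-correct; procSteps-bound; procSpace-bound)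
open import Data.Nat using (ℕ; _≤_; _*_)
open import Data.Rational using (0ℚ; _<_)
open import Data.Product using (∃; _×_; _,_)
open import Relation.Binary.PropositionalEquality using (_≡_)

mainTheorem3 :
    ((n q p : ℕ) → 1 ≤ n → 2 ≤ q → 1 ≤ p → p ≤ n →
      DiagonalisableOverℚ n q (adjMatrix n q p)
      × IsLargestEigenvalue n q (adjMatrix n q p) (procLambdaMax n q p)
      × IsSmallestEigenvalue n q (adjMatrix n q p) (procLambdaMin n q p)
      × procLambdaMin n q p < 0ℚ
      × procOutput n q p ≡ hoffman (procLambdaMax n q p) (procLambdaMin n q p))
    × (∃ λ C → (n q p : ℕ) → 1 ≤ n → 2 ≤ q → 1 ≤ p → p ≤ n →
        procSteps n q p ≤ C * n * p)
    × (∃ λ C → (n q p : ℕ) → 1 ≤ n → 2 ≤ q → 1 ≤ p → p ≤ n →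
        procSpace n q p ≤ C * n)
mainTheorem3 =
  procedure-correct ,
  (12 , λ n q p 1≤n _ 1≤p _ → procSteps-bound n q p 1≤n 1≤p) ,
  (4 , λ n q p 1≤n _ _ _ → procSpace-bound n q p 1≤n)
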